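{- Let $n\geq 3$, and let $\mathcal{F}^1=\{F_r^1: 1\leq r\leq 2n-1\}$ and $\mathcal{F}^2=\{F_r^2: 1\leq r\leq 2n+1\}$ be as constructed in the context. Then $\mathcal{F}^1$ is a one-factorisation of $K_{2n}$ and $\mathcal{F}^2$ is a one-factorisation of $K_{2n+2}$. Moreover, the number of edges $\{x,y\}$ of $K_{2n}$ such that $\{x,y\}\in F_r^1\cap F_{r'}^2$ for some $r,r'$ with $r'\equiv r \pmod{2n-1}$ (i.e. the number of common fixtures when $F_r^1$ is the draw of division one in rounds $r$ and $r+2n-1$ and $F_{r'}^2$ is the draw of division two in round $r'$) equals $2n^2-3n+4$.
   Context: $K_{2n}$ is the complete graph on vertex set $V_1=\{0,1,\ldots,2n-3\}\cup\{ -\infty,\infty\}$ and $K_{2n+2}$ the complete graph on $V_2=V_1\cup\{ -i\infty,i\infty\}$, where $\pm\infty,\pm i\infty$ are four distinct symbols. A one-factor is a set of edges covering every vertex exactly once; a one-factorisation is a set of pairwise edge-disjoint one-factors whose union is all edges. Let $\sigma$ be the permutation of $V_2$ with $\sigma(x)=x+1 \bmod (2n-2)$ for $0\leq x\leq 2n-3$ and fixing $\pm\infty,\pm i\infty$; it acts on edges by $\sigma(\{x,y\})=\{\sigma(x),\sigma(y)\}$. Define $s=\frac{n-4}{2}$, $u=\frac{3n-6}{2}$ if $n$ is even and $s=\frac{n-3}{2}$, $u=\frac{3n-7}{2}$ if $n$ is odd; $t=n-2-s$, $v=3n-5-u$. Let $E_1=\{\{x,n-2-x\}: 0\leq x\leq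 s\}$, $E_2=\{\{x,3n-5-x\}: n-1\leq x\leq u\}$, $E_3=\{\{\frac{n-2}{2},-\infty\},\{2n-3,\infty\}\}$ ($n$ even) or $\{\{\frac{3n-5}{2},-\infty\},\{2n-3,\infty\}\}$ ($n$ odd), $E_4=\{\{u,-i\infty\},\{v,i\infty\}\}$ ($n$ even) or $\{\{s,-i\infty\},\{t,i\infty\}\}$ ($n$ odd). Let $e^*=\{u,v\}$ if $n$ is even and $e^*=\{s,t\}$ if $n$ is odd. Set $F_1^1=E_1\cup E_2\cup E_3$ and $F_1^2=(F_1^1\cup E_4)\setminus\{e^*\}$. For $1\leq r\leq 2n-2$ and $d=1,2$ put $F_r^d=\sigma^{r-1}(F_1^d)$. Put $F_{2n-1}^1=\{\{x,x+n-1\}:0\leq x\leq n-2\}\cup\{\{ -\infty,\infty\}\}$ and $F_{2n-1}^2=F_{2n-1}^1\cup\{\{ -i\infty,i\infty\}\}$. Let $T_1=\{\sigma^{2j}(e^*): 0\leq j\leq n-2\}$, $T_2=\sigma(T_1)$, and $F_{2n}^2=T_1\cup\{\{ -\infty,-i\infty\},\{\infty,i\infty\}\}$, $F_{2n+1}^2=T_2\cup\{\{ -\infty,i\infty\},\{\infty,-i\infty\}\}$. -}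

module Defs where

open import Data.Nat using (ℕ; zero; suc; _+_; _*_; _∸_; _≤_; _/_; _%_; _≡ᵇ_)
open import Data.Bool using (Bool; if_then_else_)
open import Data.List using (List; []; _∷_; _++_; map; upTo; length)
open import Data.List.Relation.Unary.Any using (Any)
open import Data.List.Relation.Unary.All using (All)
open import Data.List.Relation.Unary.AllPairs using (AllPairs)
open import Data.Product using (_×_; _,_; Σ; ∃; ∃₂)
open import Data.Sum using (_⊎_)
open import Data.Unit using (⊤)
open import Data.Empty using (⊥)
open import Relation.Nullary using (¬_)
open import Relation.Binary.PropositionalEquality using (_≡_; _≢_)

-- Vertices: numbers 0..2n-3 (as ℕ, validity given by V₁/V₂ below)
-- and the four symbols -∞, ∞, -i∞, i∞.

data Pt : Set where
  num   : ℕ → Pt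
  nInf  : Pt
  pInf  : Pt
  niInf : Pt
  piInf : Pt

md : ℕ → ℕ
md n = 2 * n ∸ 2

-- x mod d (d is nonzero in all uses, since n ≥ 3)
modℕ : ℕ → ℕ → ℕ
modℕ x zero    = x
modℕ x (suc d) = x % suc d

V₁ : ℕ → Pt → Set
V₁ n (num x) = suc x ≤ md n
V₁ n nInf    = ⊤
V₁ n pInf    = ⊤
V₁ n niInf   = ⊥
V₁ n piInf   = ⊥

V₂ : ℕ → Pt → Set
V₂ n (num x) = suc x ≤ md n
V₂ n nInf    = ⊤
V₂ n pInf    = ⊤
V₂ n niInf   = ⊤
V₂ n piInf   = ⊤

σ : ℕ → Pt → Pt
σ n (num x) = num (modℕ (suc x) (md n))
σ n nInf    = nInf
σ n pInf    = pInf
σ n niInf   = niInf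
σ n piInf   = piInf

σ^ : ℕ → ℕ → Pt → Pt
σ^ n zero    p = p
σ^ n (suc k) p = σ n (σ^ n k p)

-- Edges (unordered pairs, written as ordered pairs up to Same)
-- and edge sets (predicates: F x y means {x,y} ∈ F).

Edge : Set
Edge = Pt × Pt

Same : Edge → Edge → Set
Same (a , b) (c , d) = (a ≡ c × b ≡ d) ⊎ (a ≡ d × b ≡ c)

mapE : (Pt → Pt) → Edge → Edge
mapE f (a , b) = (f a , f b)

EdgeSet : Set₁
EdgeSet = Pt → Pt → Set

⟦_⟧ : List Edge → EdgeSet
⟦ L ⟧ x y = Any (λ e → Same e (x , y)) L

_∪_ : EdgeSet → EdgeSet → EdgeSet
(A ∪ B) x y = A x y ⊎ B x y

_∖_ : EdgeSet → Edge → EdgeSet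
(A ∖ e) x y = A x y × ¬ Same e (x , y)

img : (Pt → Pt) → EdgeSet → EdgeSet
img f A x y = ∃₂ λ a b → A a b × f a ≡ x × f b ≡ y

IsOneFactor : (Pt → Set) → EdgeSet → Set
IsOneFactor P F =
  (∀ x y → F x y → P x × P y × x ≢ y) ×
  (∀ x → P x → ∃ λ y → F x y) ×
  (∀ x y z → F x y → F x z → y ≡ z)

IsOneFactorisation : (Pt → Set) → ℕ → (ℕ → EdgeSet) → Set
IsOneFactorisation P k F =
  (∀ r → 1 ≤ r → r ≤ k → IsOneFactor P (F r)) ×
  (∀ r r' → 1 ≤ r → r ≤ k → 1 ≤ r' → r' ≤ k → r ≢ r' →
     ∀ x y → F r x y → F r' x y → ⊥) ×
  (∀ x y → P x → P y → x ≢ y → ∃ λ r → 1 ≤ r × r ≤ k × F r x y)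

isEven : ℕ → Bool
isEven n = n % 2 ≡ᵇ 0

-- the list a, a+1, ..., b  (empty if b < a)
fromTo : ℕ → ℕ → List ℕ
fromTo a b = map (a +_) (upTo (suc b ∸ a))

s u t v : ℕ → ℕ
s n = if isEven n then (n ∸ 4) / 2 else (n ∸ 3) / 2
u n = if isEven n then (3 * n ∸ 6) / 2 else (3 * n ∸ 7) / 2
t n = n ∸ 2 ∸ s n
v n = 3 * n ∸ 5 ∸ u n

E₁ E₂ E₃ E₄ : ℕ → List Edge
E₁ n = map (λ x → (num x , num (n ∸ 2 ∸ x))) (fromTo 0 (s n))
E₂ n = map (λ x → (num x , num (3 * n ∸ 5 ∸ x))) (fromTo (n ∸ 1) (u n))
E₃ n = if isEven n
       then (num ((n ∸ 2) / 2) , nInf) ∷ (num (2 * n ∸ 3) , pInf) ∷ []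
       else (num ((3 * n ∸ 5) / 2) , nInf) ∷ (num (2 * n ∸ 3) , pInf) ∷ []
E₄ n = if isEven n
       then (num (u n) , niInf) ∷ (num (v n) , piInf) ∷ []
       else (num (s n) , niInf) ∷ (num (t n) , piInf) ∷ []

e* : ℕ → Edge
e* n = if isEven n then (num (u n) , num (v n)) else (num (s n) , num (t n))

F¹₁ F²₁ : ℕ → EdgeSet
F¹₁ n = ⟦ E₁ n ++ E₂ n ++ E₃ n ⟧
F²₁ n = (F¹₁ n ∪ ⟦ E₄ n ⟧) ∖ e* n

Flast¹ Flast² : ℕ → EdgeSet
Flast¹ n = ⟦ map (λ x → (num x , num (x + (n ∸ 1)))) (fromTo 0 (n ∸ 2))
             ++ (nInf , pInf) ∷ [] ⟧
Flast² n = Flast¹ n ∪ ⟦ (niInf , piInf) ∷ [] ⟧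

T₁ T₂ : ℕ → EdgeSet
T₁ n x y = ∃ λ j → j ≤ n ∸ 2 × Same (mapE (σ^ n (2 * j)) (e* n)) (x , y)
T₂ n = img (σ n) (T₁ n)

-- F^1_r  (meaningful for 1 ≤ r ≤ 2n-1)
F¹ : ℕ → ℕ → EdgeSet
F¹ n r = if r ≡ᵇ 2 * n ∸ 1 then Flast¹ n else img (σ^ n (r ∸ 1)) (F¹₁ n)

-- F^2_r  (meaningful for 1 ≤ r ≤ 2n+1)
F² : ℕ → ℕ → EdgeSet
F² n r =
  if r ≡ᵇ 2 * n ∸ 1 then Flast² n else
  if r ≡ᵇ 2 * n then T₁ n ∪ ⟦ (nInf , niInf) ∷ (pInf , piInf) ∷ [] ⟧ else
  if r ≡ᵇ 2 * n + 1 then T₂ n ∪ ⟦ (nInf , piInf) ∷ (pInf , niInf) ∷ [] ⟧ else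
  img (σ^ n (r ∸ 1)) (F²₁ n)

CongMod : ℕ → ℕ → ℕ → Set
CongMod m a b = ∃ λ k → (a ≡ b + k * m) ⊎ (b ≡ a + k * m)

Common : ℕ → Pt → Pt → Set
Common n x y = ∃₂ λ r r' →
  1 ≤ r × r ≤ 2 * n ∸ 1 × 1 ≤ r' × r' ≤ 2 * n + 1 ×
  CongMod (2 * n ∸ 1) r' r × F¹ n r x y × F² n r' x y

-- "the number of edges {x,y} of K_{2n} with Common n x y is N":
-- a duplicate-free list of exactly N such edges enumerating all of them
NumCommonEdges : ℕ → ℕ → Set
NumCommonEdges n N = ∃ λ (L : List Edge) →
  length L ≡ N ×
  AllPairs (λ e f → ¬ Same e f) L ×
  All (λ { (x , y) → V₁ n x × V₁ n y × x ≢ y × Common n x y }) L ×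
  (∀ x y → V₁ n x → V₁ n y → x ≢ y → Common n x y →
     Any (λ e → Same e (x , y)) L)

module Submission where

-- Theorem 4.2.  Write n = N + 2; the numeric vertices form ℤ_m, m = 2N + 2.
-- A family of edge sets is a one-factorisation once each round r is the graph of
-- a fixed-point-free partner function π r and a round function ρ inverts it
-- (OneFactorisationCriterion).  The base factor F_1 is the graph of β, which
-- pairs [0, N] by a ↦ N - a and [N+1, 2N] by a ↦ 3N+1 - a, matching the fixed
-- point h with -∞ and 2N+1 with ∞; round k+1 is its rotation σ^k ∘ β ∘ σ^{-k}.
-- So a numeric edge of gap d = y - x lies in the rotation carrying the unique base
-- edge {a, a + d} (a = gapPoint d) onto it; round 2n-1 holds the diameters and
-- rounds 2n, 2n+1 of F² the alternating matchings T₁, T₂ of the gap ±1 edges.  The common edges are listed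
-- explicitly: F¹ and F² agree in the first 2n-1 rounds except on the edges of gap
-- ±1, of which only e* and σ(e*) are common, giving 2n² - 3n + 4 edges.

open import Defs
open import Data.Nat using (ℕ; zero; suc; _+_; _*_; _∸_; _≤_; _<_; _/_; _%_; _≡ᵇ_; z≤n; s≤s; NonZero; _≤?_; _≟_)
open import Data.Nat.Properties
open import Data.Nat.DivMod using (m%n<n; m%n%n≡m%n; [m+n]%n≡m%n; [m+kn]%n≡m%n; m<n⇒m%n≡m; %-distribˡ-+; m*n%n≡0; m*n/n≡m)
open import Data.Bool using (Bool; true; false; if_then_else_; not; T)
open import Data.List using (List; []; _∷_; _++_; map; upTo; length)
open import Data.List.Properties using (length-++; length-map; length-upTo)
open import Data.List.Relation.Unary.Any using (Any; here; there)
import Data.List.Relation.Unary.Any.Properties as AnyP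
open import Data.List.Relation.Unary.All using (All; []; _∷_) renaming (tabulate to allTab)
open import Data.List.Relation.Unary.AllPairs using (AllPairs; []; _∷_)
import Data.List.Relation.Unary.AllPairs.Properties as APP
open import Data.List.Membership.Propositional using (_∈_; find; lose)
open import Data.List.Membership.Propositional.Properties
open import Data.Product hiding (map)
open import Data.Sum using (_⊎_; inj₁; inj₂; [_,_])
open import Data.Unit using (⊤; tt)
open import Data.Empty
open import Relation.Nullary
open import Relation.Binary.Definitions using (tri<; tri≈; tri>)
open import Relation.Binary.PropositionalEquality hiding ([_])
open import Data.Nat.Tactic.RingSolver
open import Function using (id)

module OneFactorisationCriterion
  (P : Pt → Set) (k : ℕ) (F : ℕ → EdgeSet) (π : ℕ → Pt → Pt) (ρ : Pt → Pt → ℕ)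
  (F⇒partner : ∀ r → 1 ≤ r → r ≤ k → ∀ x y → F r x y → P x × y ≡ π r x)
  (partner∈F : ∀ r → 1 ≤ r → r ≤ k → ∀ x → P x → F r x (π r x))
  (partner-valid : ∀ r → 1 ≤ r → r ≤ k → ∀ x → P x → P (π r x) × π r x ≢ x)
  (round-of-partner : ∀ r → 1 ≤ r → r ≤ k → ∀ x → P x → ρ x (π r x) ≡ r)
  (partner-of-round : ∀ x y → P x → P y → x ≢ y → 1 ≤ ρ x y × ρ x y ≤ k × π (ρ x y) x ≡ y)
  where

  round-unique : ∀ r → 1 ≤ r → r ≤ k → ∀ x y → F r x y → r ≡ ρ x y
  round-unique r p q x y f with F⇒partner r p q x y f
  ... | px , e = trans (sym (round-of-partner r p q x px)) (cong (ρ x) (sym e))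

  round-range : ∀ x y → P x → P y → x ≢ y → 1 ≤ ρ x y × ρ x y ≤ k
  round-range x y px py ne = let (a , b , _) = partner-of-round x y px py ne in a , b

  edge∈round : ∀ x y → P x → P y → x ≢ y → F (ρ x y) x y
  edge∈round x y px py ne with partner-of-round x y px py ne
  ... | a , b , c = subst (F (ρ x y) x) c (partner∈F (ρ x y) a b x px)

  oneFactorisation : IsOneFactorisation P k F
  oneFactorisation = factor , disjoint , (λ x y px py ne → ρ x y , proj₁ (round-range x y px py ne) , proj₂ (round-range x y px py ne) , edge∈round x y px py ne)
    where
    factor : ∀ r → 1 ≤ r → r ≤ k → IsOneFactor P (F r)
    factor r p q = valid , (λ x px → π r x , partner∈F r p q x px)
                 , (λ x y z f g → trans (proj₂ (F⇒partner r p q x y f)) (sym (proj₂ (F⇒partner r p q x z g))))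
      where
      valid : ∀ x y → F r x y → P x × P y × x ≢ y
      valid x y f with F⇒partner r p q x y f
      ... | px , refl = px , proj₁ (partner-valid r p q x px) , λ e → proj₂ (partner-valid r p q x px) (sym e)
    disjoint : ∀ r r' → 1 ≤ r → r ≤ k → 1 ≤ r' → r' ≤ k → r ≢ r' → ∀ x y → F r x y → F r' x y → ⊥
    disjoint r r' p q p' q' ne x y f g = ne (trans (round-unique r p q x y f) (sym (round-unique r' p' q' x y g)))

GraphOf : (Pt → Set) → EdgeSet → (Pt → Pt) → Set
GraphOf P E π = (∀ x y → E x y → P x × y ≡ π x) × (∀ x → P x → E x (π x))

image-partner : (P : Pt → Set) (f g : Pt → Pt) (B : EdgeSet) (β : Pt → Pt)
  → (∀ a → P a → g (f a) ≡ a) → (∀ x → P x → f (g x) ≡ x) → (∀ a → P a → P (f a)) → (∀ x → P x → P (g x))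
  → GraphOf P B β → GraphOf P (img f B) (λ x → f (β (g x)))
image-partner P f g B β gf fg Pf Pg (B→ , B←) =
  (λ { x y (a , b , Bab , refl , refl) →
        Pf a (proj₁ (B→ a b Bab)) , cong f (trans (proj₂ (B→ a b Bab)) (cong β (sym (gf a (proj₁ (B→ a b Bab)))))) })
  , λ x px → g x , β (g x) , B← (g x) (Pg x px) , fg x px , refl

ev : ℕ → Bool
ev zero = true
ev (suc zero) = false
ev (suc (suc k)) = ev k

half : ℕ → ℕ
half zero = zero
half (suc zero) = zero
half (suc (suc k)) = suc (half k)

half-spec : ∀ c → (ev c ≡ true × c ≡ half c + half c) ⊎ (ev c ≡ false × c ≡ suc (half c + half c))
half-spec zero = inj₁ (refl , refl)
half-spec (suc zero) = inj₂ (refl , refl)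
half-spec (suc (suc c)) with half-spec c
... | inj₁ (e , q) = inj₁ (e , cong suc (trans (cong suc q) (sym (+-suc (half c) (half c)))))
... | inj₂ (e , q) = inj₂ (e , cong suc (trans (cong suc q) (cong suc (sym (+-suc (half c) (half c))))))

ev-suc : ∀ c → ev (suc c) ≡ not (ev c)
ev-suc zero = refl
ev-suc (suc zero) = refl
ev-suc (suc (suc c)) = ev-suc c

ev-double : ∀ k → ev (k + k) ≡ true
ev-double zero = refl
ev-double (suc k) rewrite +-suc k k = ev-double k

ev-double1 : ∀ k → ev (suc (k + k)) ≡ false
ev-double1 k rewrite ev-suc (k + k) | ev-double k = refl

ev≢od : ∀ x y → x + x ≢ suc (y + y)
ev≢od x y e with trans (sym (ev-double x)) (trans (cong ev e) (ev-double1 y))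
... | ()

double-inj : ∀ x y → x + x ≡ y + y → x ≡ y
double-inj zero zero e = refl
double-inj (suc x) (suc y) e rewrite +-suc x x | +-suc y y = cong suc (double-inj x y (suc-injective (suc-injective e)))

≡ᵇ-false : ∀ a b → a ≢ b → (a ≡ᵇ b) ≡ false
≡ᵇ-false a b ne with a ≡ᵇ b in eq
... | false = refl
... | true = ⊥-elim (ne (≡ᵇ⇒≡ a b (subst T (sym eq) tt)))

≡ᵇ-true : ∀ a → (a ≡ᵇ a) ≡ true
≡ᵇ-true zero = refl
≡ᵇ-true (suc a) = ≡ᵇ-true a

wit : ∀ {a b} → a ≤ b → ∃ λ c → b ≡ a + c
wit le = let (c , e) = m≤n⇒∃[o]m+o≡n le in c , sym e

≤w : ∀ {a b} c → b ≡ a + c → a ≤ b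
≤w {a} c refl = m≤m+n a c

lt-wit : ∀ {a b} → a < b → ∃ λ c → b ≡ a + suc c
lt-wit {a} lt = let (c , e) = wit lt in c , trans e (sym (+-suc a c))

anyUp→ : ∀ {P : ℕ → Set} a k → Any P (map (a +_) (upTo k)) → ∃ λ i → i < k × P (a + i)
anyUp→ a k p with find (AnyP.map⁻ p)
... | i , i∈ , pi = i , ∈-upTo⁻ i∈ , pi

anyUp← : ∀ {P : ℕ → Set} a k i → i < k → P (a + i) → Any P (map (a +_) (upTo k))
anyUp← a k i lt pi = AnyP.map⁺ (lose (∈-upTo⁺ lt) pi)

anyFT→ : ∀ {P : ℕ → Set} a b → Any P (fromTo a b) → ∃ λ x → a ≤ x × x ≤ b × P x
anyFT→ a b p with anyUp→ a (suc b ∸ a) p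
... | i , lt , pi = a + i , m≤m+n a i , bnd , pi
  where
  bnd : a + i ≤ b
  bnd with a ≤? suc b
  ... | yes le = ≤-pred (subst (a + i <_) (m+[n∸m]≡n le) (+-monoʳ-< a lt))
  ... | no nle = ⊥-elim (<⇒≱ lt (subst (_≤ i) (sym (m≤n⇒m∸n≡0 (<⇒≤ (≰⇒> nle)))) z≤n))

anyFT← : ∀ {P : ℕ → Set} a b x → a ≤ x → x ≤ b → P x → Any P (fromTo a b)
anyFT← {P} a b x le1 le2 px = anyUp← a (suc b ∸ a) (x ∸ a) (∸-monoˡ-< (s≤s le2) le1) (subst P (sym (m+[n∸m]≡n le1)) px)

num-inj : ∀ {a b} → num a ≡ num b → a ≡ b
num-inj refl = refl

Distinct : Edge → Edge → Set
Distinct e f = ¬ Same e f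

AP++ : ∀ {xs ys} → AllPairs Distinct xs → AllPairs Distinct ys → (∀ {e f} → e ∈ xs → f ∈ ys → Distinct e f) → AllPairs Distinct (xs ++ ys)
AP++ a b h = APP.++⁺ a b (allTab (λ e∈ → allTab (λ f∈ → h e∈ f∈)))

APmap : ∀ (f : ℕ → Edge) k → (∀ {i j} → i < j → Same (f i) (f j) → ⊥) → AllPairs Distinct (map f (upTo k))
APmap f k h = APP.map⁺ (APP.applyUpTo⁺₁ id k (λ i<j _ → h i<j))

mem-map : ∀ {f : ℕ → Edge} {k e} → e ∈ map f (upTo k) → ∃ λ i → i < k × e ≡ f i
mem-map p with ∈-map⁻ _ p
... | i , i∈ , refl = i , ∈-upTo⁻ i∈ , refl

-- The "kind" of an edge (how many endpoints are numbers, -∞, ∞, …) is a key that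
-- Same preserves, so edges of different kinds are distinct.
kindP : Pt → ℕ
kindP (num _) = 1
kindP nInf = 2
kindP pInf = 4
kindP niInf = 8
kindP piInf = 16

kind : Edge → ℕ
kind (a , b) = kindP a + kindP b

kind-Same : ∀ {e f} → Same e f → kind e ≡ kind f
kind-Same {a , b} (inj₁ (refl , refl)) = refl
kind-Same {a , b} (inj₂ (refl , refl)) = +-comm (kindP a) (kindP b)

byKind : ∀ {e f} → kind e ≢ kind f → Distinct e f
byKind ne s = ne (kind-Same s)

-- pairsUpTo Y lists the numeric edges {a,b} with a + 1 < b < Y (gap at least 2),
-- each once; there are Tri Y of them, with 2 * Tri (Y+1) = Y (Y-1).

pairsUpTo : ℕ → List Edge
pairsUpTo zero = []
pairsUpTo (suc Y) = pairsUpTo Y ++ map (λ x → (num x , num Y)) (upTo (Y ∸ 1))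

Tri : ℕ → ℕ
Tri zero = 0
Tri (suc Y) = Tri Y + (Y ∸ 1)

length-pairs : ∀ Y → length (pairsUpTo Y) ≡ Tri Y
length-pairs zero = refl
length-pairs (suc Y) = trans (length-++ (pairsUpTo Y)) (cong₂ _+_ (length-pairs Y) (trans (length-map _ (upTo (Y ∸ 1))) (length-upTo (Y ∸ 1))))

2Tri : ∀ Y → 2 * Tri (suc Y) ≡ Y * (Y ∸ 1)
2Tri zero = refl
2Tri (suc zero) = refl
2Tri (suc (suc Y)) = trans (*-distribˡ-+ 2 (Tri (suc (suc Y))) (suc Y)) (trans (cong (_+ 2 * suc Y) (2Tri (suc Y))) (lem Y))
  where lem : ∀ Y → suc Y * Y + 2 * suc Y ≡ suc (suc Y) * suc Y
        lem = solve-∀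

<∸1 : ∀ {x Y} → x < Y ∸ 1 → suc x < Y
<∸1 {x} {suc Y} lt = s≤s lt

<∸1' : ∀ {x Y} → suc x < Y → x < Y ∸ 1
<∸1' {x} {suc Y} (s≤s lt) = lt

pairs∈ : ∀ Y {e} → e ∈ pairsUpTo Y → Σ ℕ λ a → Σ ℕ λ b → e ≡ (num a , num b) × suc a < b × b < Y
pairs∈ (suc Y) p with ∈-++⁻ (pairsUpTo Y) p
... | inj₁ q = let (a , b , e , l1 , l2) = pairs∈ Y q in a , b , e , l1 , m≤n⇒m≤1+n l2
... | inj₂ q = let (i , lt , e) = mem-map q in i , Y , e , <∸1 lt , ≤-refl

pairs∋ : ∀ Y {a b} → suc a < b → b < Y → (num a , num b) ∈ pairsUpTo Y
pairs∋ (suc Y) {a} {b} l1 l2 with m≤n⇒m<n∨m≡n (≤-pred l2)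
... | inj₁ lt = ∈-++⁺ˡ (pairs∋ Y l1 lt)
... | inj₂ refl = ∈-++⁺ʳ (pairsUpTo Y) (∈-map⁺ (λ x → (num x , num Y)) (∈-upTo⁺ (<∸1' l1)))

ordered-Same : ∀ {a b a' b'} → a < b → a' < b' → Same (num a , num b) (num a' , num b') → a ≡ a' × b ≡ b'
ordered-Same _ _ (inj₁ (p , q)) = num-inj p , num-inj q
ordered-Same lt lt' (inj₂ (p , q)) = ⊥-elim (<-asym lt (subst₂ _<_ (sym (num-inj q)) (sym (num-inj p)) lt'))

pairs-distinct : ∀ Y → AllPairs Distinct (pairsUpTo Y)
pairs-distinct zero = []
pairs-distinct (suc Y) = AP++ (pairs-distinct Y)
    (APmap (λ x → (num x , num Y)) (Y ∸ 1)
      (λ { i<j (inj₁ (e , _)) → <-irrefl (num-inj e) i<j ; i<j (inj₂ (e , e')) → <-irrefl (trans (num-inj e) (num-inj e')) i<j }))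
    older≢newer
  where
  older≢newer : ∀ {e f} → e ∈ pairsUpTo Y → f ∈ map (λ x → (num x , num Y)) (upTo (Y ∸ 1)) → Distinct e f
  older≢newer e∈ f∈ with pairs∈ Y e∈ | mem-map f∈
  ... | a , b , refl , l1 , l2 | i , lt , refl = λ s → <-irrefl (proj₂ (ordered-Same (<-trans (n<1+n a) l1) (<-trans (n<1+n i) (<∸1 lt)) s)) l2

count-arith : ∀ N → 1 ≤ N → Tri (suc (N + N)) + (suc (N + N) ∸ 2) + (suc (suc (N + N)) + (suc (suc (N + N)) + 3))
                    ≡ 2 * suc (suc N) * suc (suc N) ∸ 3 * suc (suc N) + 4
count-arith (suc P) _ = trans lhs (sym rhs)
  where
  tri = Tri (suc (suc P + suc P))
  D = 2 * P * P + 9 * P + 9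
  lem1 : ∀ t P → 2 * (t + (P + suc P) + (suc (suc (suc P + suc P)) + (suc (suc (suc P + suc P)) + 3)))
                 ≡ 2 * t + 2 * (P + suc P) + 2 * (suc (suc (suc P + suc P)) + (suc (suc (suc P + suc P)) + 3))
  lem1 = solve-∀
  lem2 : ∀ P → (suc P + suc P) * (P + suc P) + 2 * (P + suc P) + 2 * (suc (suc (suc P + suc P)) + (suc (suc (suc P + suc P)) + 3))
               ≡ 2 * (2 * P * P + 9 * P + 9 + 4)
  lem2 = solve-∀
  lhs : tri + (suc (suc P + suc P) ∸ 2) + (suc (suc (suc P + suc P)) + (suc (suc (suc P + suc P)) + 3)) ≡ D + 4
  lhs = *-cancelˡ-≡ _ _ 2 (trans (lem1 tri P) (trans (cong (λ z → z + 2 * (P + suc P) + 2 * (suc (suc (suc P + suc P)) + (suc (suc (suc P + suc P)) + 3))) (2Tri (suc P + suc P))) (lem2 P)))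
  lem3 : ∀ P → 2 * suc (suc (suc P)) * suc (suc (suc P)) ≡ 3 * suc (suc (suc P)) + (2 * P * P + 9 * P + 9)
  lem3 = solve-∀
  rhs : 2 * suc (suc (suc P)) * suc (suc (suc P)) ∸ 3 * suc (suc (suc P)) + 4 ≡ D + 4
  rhs = cong (_+ 4) (trans (cong (_∸ 3 * suc (suc (suc P))) (lem3 P)) (m+n∸m≡n (3 * suc (suc (suc P))) D))

module Mod (m : ℕ) {{_ : NonZero m}} where

  infix 4 _≋_
  record _≋_ (a b : ℕ) : Set where
    constructor mk
    field get : a % m ≡ b % m
  open _≋_ public

  ≋-refl : ∀ {a} → a ≋ a
  ≋-refl = mk refl
  ≋-sym : ∀ {a b} → a ≋ b → b ≋ a
  ≋-sym (mk e) = mk (sym e)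
  ≋-trans : ∀ {a b c} → a ≋ b → b ≋ c → a ≋ c
  ≋-trans (mk e) (mk f) = mk (trans e f)
  ≡⇒≋ : ∀ {a b} → a ≡ b → a ≋ b
  ≡⇒≋ e = mk (cong (_% m) e)

  ≋+ : ∀ {a b c d} → a ≋ b → c ≋ d → a + c ≋ b + d
  ≋+ {a} {b} {c} {d} (mk p) (mk q) = mk (trans (%-distribˡ-+ a c m) (trans (cong₂ (λ x y → (x + y) % m) p q) (sym (%-distribˡ-+ b d m))))

  ≋+ˡ : ∀ {a b} c → a ≋ b → c + a ≋ c + b
  ≋+ˡ c = ≋+ (≋-refl {c})
  ≋+ʳ : ∀ {a b} c → a ≋ b → a + c ≋ b + c
  ≋+ʳ c p = ≋+ p (≋-refl {c})

  %≋ : ∀ a → a % m ≋ a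
  %≋ a = mk (m%n%n≡m%n a m)

  +m≋ : ∀ a → a + m ≋ a
  +m≋ a = mk ([m+n]%n≡m%n a m)

  <m : ∀ a → a % m < m
  <m a = m%n<n a m

  small : ∀ {a} → a < m → a % m ≡ a
  small = m<n⇒m%n≡m

  uniq : ∀ {a b} → a < m → b < m → a ≋ b → a ≡ b
  uniq p q (mk e) = trans (sym (small p)) (trans e (small q))

  mod≡ : ∀ {a b} → b < m → a ≋ b → a % m ≡ b
  mod≡ b<m (mk e) = trans e (small b<m)

  cancelʳ : ∀ {a b} c → a + c ≋ b + c → a ≋ b
  cancelʳ {a} {b} c e = ≋-trans (undo a) (≋-trans (≋+ʳ (m ∸ c % m) e) (≋-sym (undo b)))
    where
    undo : ∀ a → a ≋ (a + c) + (m ∸ c % m)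
    undo a = ≋-sym (≋-trans (≋+ʳ (m ∸ c % m) (≋+ˡ a (≋-sym (%≋ c))))
       (≋-trans (≡⇒≋ (trans (+-assoc a (c % m) (m ∸ c % m)) (cong (a +_) (m+[n∸m]≡n (<⇒≤ (<m c)))))) (+m≋ a)))

  cancelˡ : ∀ {a b} c → c + a ≋ c + b → a ≋ b
  cancelˡ {a} {b} c e = cancelʳ c (≋-trans (≡⇒≋ (+-comm a c)) (≋-trans e (≡⇒≋ (+-comm c b))))

  step≢ : ∀ {x c} → x < m → 0 < c → c < m → (x + c) % m ≢ x
  step≢ {x} {c} x<m c>0 c<m e = <⇒≢ c>0 (sym (uniq c<m (≤-<-trans z≤n x<m)
      (cancelˡ x (≋-trans (≋-sym (%≋ (x + c))) (≋-trans (≡⇒≋ e) (≡⇒≋ (sym (+-identityʳ x))))))))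

  rot-inv : ∀ x k j → x < m → k + j ≡ m → ((x + k) % m + j) % m ≡ x
  rot-inv x k j x<m e = mod≡ x<m (≋-trans (≋+ʳ j (%≋ (x + k)))
     (≋-trans (≡⇒≋ (trans (+-assoc x k j) (cong (x +_) e))) (+m≋ x)))

  gap : ℕ → ℕ → ℕ
  gap a b = (b + (m ∸ a)) % m

  gap-spec : ∀ {a} b → a < m → a + gap a b ≋ b
  gap-spec {a} b a<m = ≋-trans (≋+ˡ a (%≋ (b + (m ∸ a))))
     (≋-trans (≡⇒≋ (trans (sym (+-assoc a b (m ∸ a))) (trans (cong (_+ (m ∸ a)) (+-comm a b))
       (trans (+-assoc b a (m ∸ a)) (cong (b +_) (m+[n∸m]≡n (<⇒≤ a<m))))))) (+m≋ b))

  gap-unique : ∀ {a b d} → a < m → d < m → a + d ≋ b → gap a b ≡ d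
  gap-unique {a} {b} {d} a<m d<m e = uniq (<m (b + (m ∸ a))) d<m (cancelˡ a (≋-trans (gap-spec b a<m) (≋-sym e)))

-- The parity-dependent data of the construction for n = N + 2, in terms of
-- S N = 3n - 5 = 3N + 1.  E₁ pairs a ↦ N - a on [0, N] and E₂ pairs a ↦ S N - a
-- on [N+1, 2N]; h is the fixed point of the reflection of the right parity
-- (paired with -∞ by E₃), and e* = {e0, e0 + 1} is a pair of E₁ or E₂ with gap 1.
S : ℕ → ℕ
S N = suc (N + (N + N))

record Params (N : ℕ) : Set where
  field
    h : ℕ
    h-prop : (h ≤ N × h + h ≡ N) ⊎ (N < h × h ≤ N + N × h + h ≡ S N)
    s-lo : ∀ x → x ≤ s (suc (suc N)) → x + x < N
    s-cov : ∀ a → a ≤ N → a ≢ h → a ≤ s (suc (suc N)) ⊎ N ∸ a ≤ s (suc (suc N))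
    u-lo : ∀ x → x ≤ u (suc (suc N)) → x + x < S N
    u-cov : ∀ a → N < a → a ≤ N + N → a ≢ h → a ≤ u (suc (suc N)) ⊎ S N ∸ a ≤ u (suc (suc N))
    E₃≡ : E₃ (suc (suc N)) ≡ (num h , nInf) ∷ (num (suc (N + N)) , pInf) ∷ []
    e0 : ℕ
    e0-prop : (e0 < N × e0 + suc e0 ≡ N) ⊎ (N < e0 × e0 + suc e0 ≡ S N)
    e0-bound : suc (suc e0) < suc (suc (N + N))
    E₄≡ : E₄ (suc (suc N)) ≡ (num e0 , niInf) ∷ (num (suc e0) , piInf) ∷ []
    e*≡ : e* (suc (suc N)) ≡ (num e0 , num (suc e0))

-- If r ∈ [1, L] and r' ∈ {L+1, L+2} are congruent modulo L (> 1), then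
-- r = r' - L ∈ {1, 2}: only the first two rounds wrap around to the extra ones.
wrap-around : ∀ {L r r'} → 1 < L → 1 ≤ r → r ≤ L → CongMod L r' r → (r' ≡ suc L ⊎ r' ≡ suc (suc L)) → r ≡ 1 ⊎ r ≡ 2
wrap-around {L} {r} {r'} _ _ q (k , inj₂ e) big = ⊥-elim (<⇒≱ (≤-<-trans q (beyond big)) (≤-trans (m≤m+n r' _) (≤-reflexive (sym e))))
  where beyond : (r' ≡ suc L ⊎ r' ≡ suc (suc L)) → L < r'
        beyond (inj₁ refl) = ≤-refl
        beyond (inj₂ refl) = m≤n⇒m≤1+n ≤-refl
wrap-around {L} {r} {r'} _ _ q (zero , inj₁ e) big = ⊥-elim (<⇒≱ (beyond big) (subst (_≤ L) (sym (trans e (+-identityʳ r))) q))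
  where beyond : (r' ≡ suc L ⊎ r' ≡ suc (suc L)) → L < r'
        beyond (inj₁ refl) = ≤-refl
        beyond (inj₂ refl) = m≤n⇒m≤1+n ≤-refl
wrap-around {L} {r} _ _ _ (suc zero , inj₁ e) (inj₁ refl) = inj₁ (+-cancelʳ-≡ L r 1 (sym (trans e (cong (r +_) (+-identityʳ L)))))
wrap-around {L} {r} _ _ _ (suc zero , inj₁ e) (inj₂ refl) = inj₂ (+-cancelʳ-≡ L r 2 (sym (trans e (cong (r +_) (+-identityʳ L)))))
wrap-around {L} {r} {r'} L>1 p _ (suc (suc k) , inj₁ e) big = ⊥-elim (<⇒≱ L>1 (+-cancelʳ-≤ L L 1 (≤-pred (≤-trans lo (hi big)))))
  where
  lo : suc (L + L) ≤ r'
  lo = subst (suc (L + L) ≤_) (sym e) (+-mono-≤ p (+-monoʳ-≤ L (m≤m+n L (k * L))))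
  hi : (r' ≡ suc L ⊎ r' ≡ suc (suc L)) → r' ≤ suc (1 + L)
  hi (inj₁ refl) = m≤n⇒m≤1+n ≤-refl
  hi (inj₂ refl) = ≤-refl
-- The construction for n = N + 2 with given parity data.  Numbers live in
-- ℤ_m, m = 2N + 2; M1 = m - 1 = 2n - 3 is the vertex paired with ∞ in F¹₁.
module Construction (N : ℕ) (N≥1 : 1 ≤ N) (prm : Params N) where
  open Params prm

  n m M1 : ℕ
  n = suc (suc N)
  m = suc (suc (N + N))
  M1 = suc (N + N)

  open Mod m

  md≡ : md n ≡ m
  md≡ = lem N
    where lem : ∀ N → N + suc (suc (N + 0)) ≡ suc (suc (N + N))
          lem = solve-∀

  σ-num : ∀ z → σ n (num z) ≡ num (suc z % m)
  σ-num z = cong (λ M → num (modℕ (suc z) M)) md≡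

  σ^-num : ∀ k x → x < m → σ^ n k (num x) ≡ num ((x + k) % m)
  σ^-num zero x x<m = cong num (sym (trans (cong (_% m) (+-identityʳ x)) (small x<m)))
  σ^-num (suc k) x x<m rewrite σ^-num k x x<m = trans (σ-num ((x + k) % m))
     (cong num (get (≋-trans (≋+ˡ 1 (%≋ (x + k))) (≡⇒≋ (sym (+-suc x k))))))

  σ^-fixes : ∀ k {p} → σ n p ≡ p → σ^ n k p ≡ p
  σ^-fixes zero f = refl
  σ^-fixes (suc k) {p} f = trans (cong (σ n) (σ^-fixes k f)) f

  σ^-nI : ∀ k → σ^ n k nInf ≡ nInf
  σ^-nI k = σ^-fixes k refl
  σ^-pI : ∀ k → σ^ n k pInf ≡ pInf
  σ^-pI k = σ^-fixes k refl
  σ^-niI : ∀ k → σ^ n k niInf ≡ niInf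
  σ^-niI k = σ^-fixes k refl
  σ^-piI : ∀ k → σ^ n k piInf ≡ piInf
  σ^-piI k = σ^-fixes k refl

  SN≡ : 3 * n ∸ 5 ≡ S N
  SN≡ = trans (cong (_∸ 5) (lem N)) (m+n∸m≡n 5 (S N))
    where lem : ∀ N → 3 * suc (suc N) ≡ 5 + suc (N + (N + N))
          lem = solve-∀

  mirror : ℕ → ℕ
  mirror a with a ≤? N
  ... | yes _ = N ∸ a
  ... | no _ = S N ∸ a

  Base : ℕ → Set
  Base a = a ≤ N + N × a ≢ h

  mirror-lo : ∀ {a} → a ≤ N → mirror a ≡ N ∸ a
  mirror-lo {a} le with a ≤? N
  ... | yes _ = refl
  ... | no ¬p = ⊥-elim (¬p le)

  mirror-hi : ∀ {a} → N < a → mirror a ≡ S N ∸ a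
  mirror-hi {a} lt with a ≤? N
  ... | yes p = ⊥-elim (<⇒≱ lt p)
  ... | no _ = refl

  h-lo : ∀ {a} → a + a ≡ N → a ≡ h
  h-lo {a} e with h-prop
  ... | inj₁ (_ , hh) = double-inj a h (trans e (sym hh))
  ... | inj₂ (_ , _ , hh) = ⊥-elim (ev≢od h (a + N) (trans hh (trans (cong (λ z → suc (z + (N + N))) (sym e)) (lem a N))))
    where lem : ∀ a N → suc ((a + a) + (N + N)) ≡ suc ((a + N) + (a + N))
          lem = solve-∀

  h-hi : ∀ {a} → a + a ≡ S N → a ≡ h
  h-hi {a} e with h-prop
  ... | inj₁ (_ , hh) = ⊥-elim (ev≢od a (h + (h + h)) (trans e (trans (cong (λ z → suc (z + (z + z))) (sym hh)) (lem h))))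
    where lem : ∀ h → suc ((h + h) + ((h + h) + (h + h))) ≡ suc ((h + (h + h)) + (h + (h + h)))
          lem = solve-∀
  ... | inj₂ (_ , _ , hh) = double-inj a h (trans e (sym hh))

  N+N<S : N + N < S N
  N+N<S = s≤s (m≤n+m (N + N) N)

  reg2 : ∀ {a b} → N < a → a ≤ N + N → a + b ≡ S N → N < b × b ≤ N + N
  reg2 {a} {b} lt le e = ≰⇒> no1 , ≮⇒≥ no2
    where
    no1 : ¬ b ≤ N
    no1 b≤N = <-irrefl e (≤-<-trans (≤-trans (+-mono-≤ le b≤N) (≤-reflexive (+-comm (N + N) N))) (s≤s ≤-refl))
    no2 : ¬ N + N < b
    no2 lt2 = <-irrefl (sym e) (subst (_≤ a + b) (lem N) (+-mono-≤ lt lt2))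
      where lem : ∀ N → suc N + suc (N + N) ≡ suc (suc (N + (N + N)))
            lem = solve-∀

  sum-lo : ∀ {a} → a ≤ N → a + mirror a ≡ N
  sum-lo {a} le rewrite mirror-lo le = m+[n∸m]≡n le

  sum-hi : ∀ {a} → N < a → a ≤ N + N → a + mirror a ≡ S N
  sum-hi {a} lt le rewrite mirror-hi lt = m+[n∸m]≡n (≤-trans le (<⇒≤ N+N<S))

  mirror-back-lo : ∀ {a b} → b ≤ N → a + b ≡ N → mirror b ≡ a
  mirror-back-lo {a} {b} le e rewrite mirror-lo le = trans (cong (_∸ b) (sym e)) (m+n∸n≡m a b)

  mirror-back-hi : ∀ {a b} → N < b → a + b ≡ S N → mirror b ≡ a
  mirror-back-hi {a} {b} lt e rewrite mirror-hi lt = trans (cong (_∸ b) (sym e)) (m+n∸n≡m a b)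

  data View (a : ℕ) : Set where
    lo : a ≤ N → mirror a ≤ N → a + mirror a ≡ N → View a
    hi : N < a → a ≤ N + N → N < mirror a → mirror a ≤ N + N → a + mirror a ≡ S N → View a

  view : ∀ a → a ≤ N + N → View a
  view a le with a ≤? N
  ... | yes p = lo p (subst (_≤ N) (sym (mirror-lo p)) (m∸n≤m N a)) (sum-lo p)
  ... | no ¬p = let q = ≰⇒> ¬p ; e = sum-hi q le ; (r1 , r2) = reg2 q le e in hi q le r1 r2 e

  mirror-involution : ∀ {a} → Base a → Base (mirror a) × mirror (mirror a) ≡ a × mirror a ≢ a
  mirror-involution {a} (le , ne) with view a le
  ... | lo p q e = (≤-trans q (m≤m+n N N) , nh) , mirror-back-lo q e , λ eq → ne (h-lo (trans (cong (a +_) (sym eq)) e))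
    where nh : mirror a ≢ h
          nh eq with h-prop
          ... | inj₁ (_ , hh) = ne (+-cancelʳ-≡ h a h (trans (trans (cong (a +_) (sym eq)) e) (sym hh)))
          ... | inj₂ (lt , _ , _) = <⇒≱ lt (subst (_≤ N) eq q)
  ... | hi p p' q q' e = (q' , nh) , mirror-back-hi q e , λ eq → ne (h-hi (trans (cong (a +_) (sym eq)) e))
    where nh : mirror a ≢ h
          nh eq with h-prop
          ... | inj₁ (hle , _) = <⇒≱ q (subst (_≤ N) (sym eq) hle)
          ... | inj₂ (_ , _ , hh) = ne (+-cancelʳ-≡ h a h (trans (trans (cong (a +_) (sym eq)) e) (sym hh)))

  mirror-bound : ∀ {a} → Base a → mirror a ≤ a + N
  mirror-bound {a} (le , _) with view a le
  ... | lo _ q _ = ≤-trans q (m≤n+m N a)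
  ... | hi p _ _ q' _ = ≤-trans q' (+-monoˡ-≤ N (<⇒≤ p))

  inj-same : ∀ {a a' d T} → a + (a + d) ≡ T → a' + (a' + d) ≡ T → a ≡ a'
  inj-same {a} {a'} {d} e e' = double-inj a a' (+-cancelʳ-≡ d (a + a) (a' + a')
      (trans (+-assoc a a d) (trans e (trans (sym e') (sym (+-assoc a' a' d))))))

  inj-mixed : ∀ {a a' d} → a + (a + d) ≡ N → a' + (a' + d) ≡ S N → ⊥
  inj-mixed {a} {a'} {d} e e' = ev≢od a' (a + N) (+-cancelʳ-≡ d (a' + a') (suc ((a + N) + (a + N)))
     (trans (+-assoc a' a' d) (trans e' (trans (cong (λ z → suc (z + (N + N))) (sym e)) (lem a N d)))))
    where lem : ∀ a N d → suc ((a + (a + d)) + (N + N)) ≡ suc ((a + N) + (a + N)) + d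
          lem = solve-∀

  sum' : ∀ {a d} → a + mirror a ≡ N → mirror a ≡ a + d → a + (a + d) ≡ N
  sum' {a} e q = trans (cong (a +_) (sym q)) e
  sumS : ∀ {a d} → a + mirror a ≡ S N → mirror a ≡ a + d → a + (a + d) ≡ S N
  sumS {a} e q = trans (cong (a +_) (sym q)) e

  mirror-shift-injective : ∀ {a a' d} → Base a → Base a' → mirror a ≡ a + d → mirror a' ≡ a' + d → a ≡ a'
  mirror-shift-injective {a} {a'} {d} (le , _) (le' , _) q q' with view a le | view a' le'
  ... | lo _ _ e | lo _ _ e' = inj-same {a} {a'} {d} (sum' {a} {d} e q) (sum' {a'} {d} e' q')
  ... | hi _ _ _ _ e | hi _ _ _ _ e' = inj-same {a} {a'} {d} (sumS {a} {d} e q) (sumS {a'} {d} e' q')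
  ... | lo _ _ e | hi _ _ _ _ e' = ⊥-elim (inj-mixed {a} {a'} {d} (sum' {a} {d} e q) (sumS {a'} {d} e' q'))
  ... | hi _ _ _ _ e | lo _ _ e' = ⊥-elim (inj-mixed {a'} {a} {d} (sum' {a'} {d} e' q') (sumS {a} {d} e q))

  -- For each gap 1 ≤ d ≤ N exactly one base vertex a has mirror a = a + d: it is
  -- (N - d)/2 if N - d is even, and N + 1 + (N - d - 1)/2 otherwise.
  gapPoint-even : ∀ {d j} → 1 ≤ d → N ≡ j + (j + d) → Base j × mirror j ≡ j + d
  gapPoint-even {d} {j} d≥1 eN = (≤-trans jN (m≤m+n N N) , jh) , trans (mirror-lo jN) (trans (cong (_∸ j) eN) (m+n∸m≡n j (j + d)))
    where
    jN : j ≤ N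
    jN = ≤w (j + d) eN
    jh : j ≢ h
    jh eq with h-prop
    ... | inj₁ (_ , hh) = <⇒≢ d≥1 (sym (+-cancelˡ-≡ (j + j) d 0 (trans (+-assoc j j d)
                            (trans (sym eN) (trans (sym hh) (trans (cong₂ _+_ (sym eq) (sym eq)) (sym (+-identityʳ (j + j)))))))))
    ... | inj₂ (lt , _ , _) = <⇒≱ lt (subst (_≤ N) eq jN)

  gapPoint-odd : ∀ {d j} → 1 ≤ d → N ≡ suc (j + j) + d → Base (suc (N + j)) × mirror (suc (N + j)) ≡ suc (N + j) + d
  gapPoint-odd {d} {j} d≥1 eN = (aN , ah) , trans (mirror-hi lt) (trans (cong (_∸ a) (sym sumA)) (m+n∸m≡n a (a + d)))
    where
    a = suc (N + j)
    sumA : a + (a + d) ≡ S N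
    sumA = trans (lem N j d) (cong (λ z → suc (N + (N + z))) (sym eN))
      where lem : ∀ N j d → suc (N + j) + (suc (N + j) + d) ≡ suc (N + (N + (suc (j + j) + d)))
            lem = solve-∀
    lt : N < a
    lt = s≤s (m≤m+n N j)
    aN : a ≤ N + N
    aN = subst (_≤ N + N) (+-suc N j) (+-monoʳ-≤ N (≤w (j + d) (trans eN (cong suc (+-assoc j j d)))))
    ah : a ≢ h
    ah eq with h-prop
    ... | inj₁ (hle , _) = <⇒≱ lt (subst (_≤ N) (sym eq) hle)
    ... | inj₂ (_ , _ , hh) = <⇒≢ d≥1 (sym (+-cancelˡ-≡ (a + a) d 0 (trans (+-assoc a a d)
            (trans sumA (trans (sym hh) (trans (cong₂ _+_ (sym eq) (sym eq)) (sym (+-identityʳ (a + a)))))))))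

  gapPoint : ℕ → ℕ
  gapPoint d with half-spec (N ∸ d)
  ... | inj₁ _ = half (N ∸ d)
  ... | inj₂ _ = suc (N + half (N ∸ d))

  gapPoint-spec : ∀ {d} → 1 ≤ d → d ≤ N → Base (gapPoint d) × mirror (gapPoint d) ≡ gapPoint d + d
  gapPoint-spec {d} d≥1 d≤N with half-spec (N ∸ d)
  ... | inj₁ (_ , q) = gapPoint-even d≥1 (trans (sym (m∸n+n≡m d≤N)) (trans (cong (_+ d) q) (+-assoc (half (N ∸ d)) (half (N ∸ d)) d)))
  ... | inj₂ (_ , q) = gapPoint-odd d≥1 (trans (sym (m∸n+n≡m d≤N)) (cong (_+ d) q))

  gapPoint-unique : ∀ {a d} → Base a → mirror a ≡ a + d → 1 ≤ d → d ≤ N → gapPoint d ≡ a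
  gapPoint-unique {a} {d} ba q d≥1 d≤N = let (b' , q') = gapPoint-spec d≥1 d≤N in mirror-shift-injective {gapPoint d} {a} {d} b' ba q' q

  e0-base : Base e0 × mirror e0 ≡ suc e0
  e0-base with e0-prop
  ... | inj₁ (lt , e) = (≤-trans (<⇒≤ lt) (m≤m+n N N) , ne) , trans (mirror-lo (<⇒≤ lt)) (trans (cong (_∸ e0) (sym e)) (m+n∸m≡n e0 (suc e0)))
    where ne : e0 ≢ h
          ne eq with h-prop
          ... | inj₁ (_ , hh) = ev≢od h e0 (trans hh (trans (sym e) (+-suc e0 e0)))
          ... | inj₂ (hlt , _ , _) = <⇒≱ hlt (subst (_≤ N) eq (<⇒≤ lt))
  ... | inj₂ (lt , e) = (le , ne) , trans (mirror-hi lt) (trans (cong (_∸ e0) (sym e)) (m+n∸m≡n e0 (suc e0)))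
    where le : e0 ≤ N + N
          le = ≮⇒≥ λ big → <-irrefl (sym e) (≤-trans (m≤m+n (suc (S N)) (suc N)) (subst (_≤ e0 + suc e0) (lem N) (+-mono-≤ big (s≤s big))))
            where lem : ∀ N → suc (N + N) + suc (suc (N + N)) ≡ suc (suc (N + (N + N))) + suc N
                  lem = solve-∀
          ne : e0 ≢ h
          ne eq with h-prop
          ... | inj₁ (hle , _) = <⇒≱ lt (subst (_≤ N) (sym eq) hle)
          ... | inj₂ (_ , _ , hh) = ev≢od h e0 (trans hh (trans (sym e) (+-suc e0 e0)))

  v→ : ∀ {x} → suc x ≤ md n → x < m
  v→ {x} = subst (suc x ≤_) md≡
  v← : ∀ {x} → x < m → suc x ≤ md n
  v← {x} = subst (suc x ≤_) (sym md≡)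

  h≤ : h ≤ N + N
  h≤ with h-prop
  ... | inj₁ (le , _) = ≤-trans le (m≤m+n N N)
  ... | inj₂ (_ , le , _) = le

  base< : ∀ {a} → a ≤ N + N → a < m
  base< le = s≤s (m≤n⇒m≤1+n le)

  M1<m : M1 < m
  M1<m = ≤-refl

  β¹ : Pt → Pt
  β¹ (num a) with a ≟ h
  ... | yes _ = nInf
  ... | no _ with a ≟ M1
  ...   | yes _ = pInf
  ...   | no _ = num (mirror a)
  β¹ nInf = num h
  β¹ pInf = num M1
  β¹ niInf = niInf
  β¹ piInf = piInf

  M1≢h : M1 ≢ h
  M1≢h e = <⇒≱ (s≤s h≤) (≤-reflexive e)

  β¹-h : β¹ (num h) ≡ nInf
  β¹-h with h ≟ h
  ... | yes _ = refl
  ... | no ne = ⊥-elim (ne refl)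

  β¹-M1 : β¹ (num M1) ≡ pInf
  β¹-M1 with M1 ≟ h
  ... | yes e = ⊥-elim (M1≢h e)
  ... | no _ with M1 ≟ M1
  ...   | yes _ = refl
  ...   | no ne = ⊥-elim (ne refl)

  base≢M1 : ∀ {a} → a ≤ N + N → a ≢ M1
  base≢M1 le e = <⇒≱ (s≤s le) (≤-reflexive (sym e))

  β¹-base : ∀ {a} → Base a → β¹ (num a) ≡ num (mirror a)
  β¹-base {a} (le , ne) with a ≟ h
  ... | yes e = ⊥-elim (ne e)
  ... | no _ with a ≟ M1
  ...   | yes e = ⊥-elim (base≢M1 le e)
  ...   | no _ = refl

  data NumberView (a : ℕ) : Set where
    isH : a ≡ h → NumberView a
    isM1 : a ≡ M1 → NumberView a
    isB : Base a → NumberView a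

  numberView : ∀ a → a < m → NumberView a
  numberView a lt with a ≟ h
  ... | yes e = isH e
  ... | no ne with a ≟ M1
  ...   | yes e = isM1 e
  ...   | no ne' = isB (≤-pred (≤∧≢⇒< (≤-pred lt) ne') , ne)

  E₁-base : ∀ {x} → x + x < N → Base x × x ≤ N
  E₁-base {x} lt = (≤-trans xN (m≤m+n N N) , ne) , xN
    where
    xN : x ≤ N
    xN = ≤-trans (m≤m+n x x) (<⇒≤ lt)
    ne : x ≢ h
    ne e with h-prop
    ... | inj₁ (_ , hh) = <-irrefl (trans (cong₂ _+_ e e) hh) lt
    ... | inj₂ (hlt , _ , _) = <⇒≱ hlt (subst (_≤ N) e xN)

  E₂-base : ∀ {x} → N < x → x + x < S N → Base x
  E₂-base {x} nx lt = xle , ne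
    where
    xle : x ≤ N + N
    xle = ≮⇒≥ λ big → <⇒≱ lt (≤-trans (m≤m+n (S N) (suc N)) (subst (_≤ x + x) (lem N) (+-mono-≤ big big)))
      where lem : ∀ N → suc (N + N) + suc (N + N) ≡ suc (N + (N + N)) + suc N
            lem = solve-∀
    ne : x ≢ h
    ne e with h-prop
    ... | inj₁ (hle , _) = <⇒≱ nx (subst (_≤ N) (sym e) hle)
    ... | inj₂ (_ , _ , hh) = <-irrefl (trans (cong₂ _+_ e e) hh) lt

  mirror-edge-partner : ∀ {x a b} → Base x → Same (num x , num (mirror x)) (a , b) → V₁ n a × b ≡ β¹ a
  mirror-edge-partner {x} bx (inj₁ (refl , refl)) = v← (base< (proj₁ bx)) , sym (β¹-base bx)
  mirror-edge-partner {x} bx (inj₂ (refl , refl)) with mirror-involution bx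
  ... | bb , inv , _ = v← (base< (proj₁ bb)) , trans (cong num (sym inv)) (sym (β¹-base bb))

  E₃list : List Edge
  E₃list = (num h , nInf) ∷ (num M1 , pInf) ∷ []

  E₃-partner : ∀ {a b} → Any (λ e → Same e (a , b)) E₃list → V₁ n a × b ≡ β¹ a
  E₃-partner (here (inj₁ (refl , refl))) = v← (base< h≤) , sym β¹-h
  E₃-partner (here (inj₂ (refl , refl))) = tt , refl
  E₃-partner (there (here (inj₁ (refl , refl)))) = v← M1<m , sym β¹-M1
  E₃-partner (there (here (inj₂ (refl , refl)))) = tt , refl

  F¹₁→ : ∀ a b → F¹₁ n a b → V₁ n a × b ≡ β¹ a
  F¹₁→ a b p with AnyP.++⁻ (E₁ n) p
  ... | inj₁ q with anyFT→ 0 (s n) (AnyP.map⁻ q)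
  ...   | x , _ , le , sm with E₁-base (s-lo x le)
  ...     | bx , xN = mirror-edge-partner bx (subst (λ z → Same (num x , num z) (a , b)) (sym (mirror-lo xN)) sm)
  F¹₁→ a b p | inj₂ q with AnyP.++⁻ (E₂ n) q
  ... | inj₁ q' with anyFT→ (suc N) (u n) (AnyP.map⁻ q')
  ...   | x , le1 , le2 , sm = mirror-edge-partner (E₂-base le1 (u-lo x le2))
            (subst (λ z → Same (num x , num z) (a , b)) (trans (cong (_∸ x) SN≡) (sym (mirror-hi le1))) sm)
  F¹₁→ a b p | inj₂ q | inj₂ q' = E₃-partner (subst (λ L → Any (λ e → Same e (a , b)) L) E₃≡ q')

  in-E₃ : ∀ {a b} → Any (λ e → Same e (a , b)) E₃list → F¹₁ n a b
  in-E₃ {a} {b} p = AnyP.++⁺ʳ (E₁ n) (AnyP.++⁺ʳ (E₂ n) (subst (λ L → Any (λ e → Same e (a , b)) L) (sym E₃≡) p))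

  F¹₁← : ∀ a → V₁ n a → F¹₁ n a (β¹ a)
  F¹₁← (num x) v with numberView x (v→ v)
  ... | isH refl = in-E₃ (here (inj₁ (refl , sym β¹-h)))
  ... | isM1 refl = in-E₃ (there (here (inj₁ (refl , sym β¹-M1))))
  ... | isB bx with view x (proj₁ bx)
  ...   | lo p _ _ with s-cov x p (proj₂ bx)
  ...     | inj₁ le = AnyP.++⁺ˡ (AnyP.map⁺ (anyFT← 0 (s n) x z≤n le (inj₁ (refl , sym (trans (β¹-base bx) (cong num (mirror-lo p)))))))
  ...     | inj₂ le = AnyP.++⁺ˡ (AnyP.map⁺ (anyFT← 0 (s n) (N ∸ x) z≤n le
                (inj₂ (sym (trans (β¹-base bx) (cong num (mirror-lo p))) , cong num (m∸[m∸n]≡n p)))))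
  F¹₁← (num x) v | isB bx | hi p le' q _ _ with u-cov x p le' (proj₂ bx)
  ...     | inj₁ le = AnyP.++⁺ʳ (E₁ n) (AnyP.++⁺ˡ (AnyP.map⁺ (anyFT← (suc N) (u n) x p le
                (inj₁ (refl , sym (trans (β¹-base bx) (cong num (trans (mirror-hi p) (cong (_∸ x) (sym SN≡))))))))))
  ...     | inj₂ le = AnyP.++⁺ʳ (E₁ n) (AnyP.++⁺ˡ (AnyP.map⁺ (anyFT← (suc N) (u n) (S N ∸ x) (subst (N <_) (mirror-hi p) q) le
                (inj₂ (sym (trans (β¹-base bx) (cong num (mirror-hi p))) ,
                       cong num (trans (cong (_∸ (S N ∸ x)) SN≡) (m∸[m∸n]≡n (≤-trans le' (<⇒≤ N+N<S)))))))))
  F¹₁← nInf v = in-E₃ (here (inj₂ (refl , refl)))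
  F¹₁← pInf v = in-E₃ (there (here (inj₂ (refl , refl))))

  e1 : ℕ
  e1 = suc e0

  e0-isBase : Base e0
  e0-isBase = proj₁ e0-base
  e1-isBase : Base e1
  e1-isBase = subst Base (proj₂ e0-base) (proj₁ (mirror-involution e0-isBase))
  mirror-e1 : mirror e1 ≡ e0
  mirror-e1 = subst (λ z → mirror z ≡ e0) (proj₂ e0-base) (proj₁ (proj₂ (mirror-involution e0-isBase)))
  e1≢e0 : e1 ≢ e0
  e1≢e0 e = <-irrefl (sym e) ≤-refl

  β¹e0 : β¹ (num e0) ≡ num e1
  β¹e0 = trans (β¹-base e0-isBase) (cong num (proj₂ e0-base))
  β¹e1 : β¹ (num e1) ≡ num e0
  β¹e1 = trans (β¹-base e1-isBase) (cong num mirror-e1)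

  β² : Pt → Pt
  β² (num a) with a ≟ e0
  ... | yes _ = niInf
  ... | no _ with a ≟ e1
  ...   | yes _ = piInf
  ...   | no _ = β¹ (num a)
  β² nInf = β¹ nInf
  β² pInf = β¹ pInf
  β² niInf = num e0
  β² piInf = num e1

  β²-e0 : β² (num e0) ≡ niInf
  β²-e0 with e0 ≟ e0
  ... | yes _ = refl
  ... | no ne = ⊥-elim (ne refl)

  β²-e1 : β² (num e1) ≡ piInf
  β²-e1 with e1 ≟ e0
  ... | yes e = ⊥-elim (e1≢e0 e)
  ... | no _ with e1 ≟ e1
  ...   | yes _ = refl
  ...   | no ne = ⊥-elim (ne refl)

  β²-oth : ∀ {a} → a ≢ e0 → a ≢ e1 → β² (num a) ≡ β¹ (num a)
  β²-oth {a} n0 n1 with a ≟ e0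
  ... | yes e = ⊥-elim (n0 e)
  ... | no _ with a ≟ e1
  ...   | yes e = ⊥-elim (n1 e)
  ...   | no _ = refl

  V₁⇒V₂ : ∀ x → V₁ n x → V₂ n x
  V₁⇒V₂ (num x) v = v
  V₁⇒V₂ nInf v = tt
  V₁⇒V₂ pInf v = tt

  E₄list : List Edge
  E₄list = (num e0 , niInf) ∷ (num e1 , piInf) ∷ []

  e*E : Edge
  e*E = (num e0 , num e1)

  F²₁→ : ∀ a b → F²₁ n a b → V₂ n a × b ≡ β² a
  F²₁→ a b (inj₁ f , ns) with F¹₁→ a b f
  F²₁→ (num x) b (inj₁ f , ns) | v , refl with x ≟ e0
  ... | yes refl = ⊥-elim (subst (λ E → ¬ Same E (num e0 , β¹ (num e0))) e*≡ ns (inj₁ (refl , sym β¹e0)))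
  ... | no n0 with x ≟ e1
  ...   | yes refl = ⊥-elim (subst (λ E → ¬ Same E (num e1 , β¹ (num e1))) e*≡ ns (inj₂ (sym β¹e1 , refl)))
  ...   | no n1 = v , refl
  F²₁→ nInf b (inj₁ f , ns) | v , refl = tt , refl
  F²₁→ pInf b (inj₁ f , ns) | v , refl = tt , refl
  F²₁→ a b (inj₂ g , ns) with subst (λ L → Any (λ e → Same e (a , b)) L) E₄≡ g
  ... | here (inj₁ (refl , refl)) = v← (base< (proj₁ e0-isBase)) , sym β²-e0
  ... | here (inj₂ (refl , refl)) = tt , refl
  ... | there (here (inj₁ (refl , refl))) = v← (base< (proj₁ e1-isBase)) , sym β²-e1
  ... | there (here (inj₂ (refl , refl))) = tt , refl

  in-E₄ : ∀ {a b} → Any (λ e → Same e (a , b)) E₄list → (F¹₁ n ∪ ⟦ E₄ n ⟧) a b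
  in-E₄ {a} {b} p = inj₂ (subst (λ L → Any (λ e → Same e (a , b)) L) (sym E₄≡) p)

  notE* : ∀ {a b} → ¬ Same e*E (a , b) → ¬ Same (e* n) (a , b)
  notE* {a} {b} ns = subst (λ E → ¬ Same E (a , b)) (sym e*≡) ns

  E*View : ℕ → Set
  E*View x = (x ≡ e0) ⊎ (x ≡ e1) ⊎ (x ≢ e0 × x ≢ e1)

  e*View : ∀ x → E*View x
  e*View x with x ≟ e0
  ... | yes e = inj₁ e
  ... | no n0 with x ≟ e1
  ...   | yes e = inj₂ (inj₁ e)
  ...   | no n1 = inj₂ (inj₂ (n0 , n1))

  F²₁←-num : ∀ x → V₂ n (num x) → E*View x → F²₁ n (num x) (β² (num x))
  F²₁←-num x v (inj₁ refl) = subst (λ z → F²₁ n (num e0) z) (sym β²-e0) (in-E₄ (here (inj₁ (refl , refl))) , notE* λ { (inj₁ (_ , ())) ; (inj₂ (() , _)) })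
  F²₁←-num x v (inj₂ (inj₁ refl)) = subst (λ z → F²₁ n (num e1) z) (sym β²-e1) (in-E₄ (there (here (inj₁ (refl , refl)))) , notE* λ { (inj₁ (_ , ())) ; (inj₂ (() , _)) })
  F²₁←-num x v (inj₂ (inj₂ (n0 , n1))) = subst (λ z → F²₁ n (num x) z) (sym (β²-oth n0 n1)) (inj₁ (F¹₁← (num x) v) ,
              notE* λ { (inj₁ (e , _)) → n0 (sym (num-inj e)) ; (inj₂ (_ , e)) → n1 (sym (num-inj e)) })

  F²₁← : ∀ a → V₂ n a → F²₁ n a (β² a)
  F²₁← (num x) v = F²₁←-num x v (e*View x)
  F²₁← nInf v = inj₁ (F¹₁← nInf tt) , notE* λ { (inj₁ (() , _)) ; (inj₂ (_ , ())) }
  F²₁← pInf v = inj₁ (F¹₁← pInf tt) , notE* λ { (inj₁ (() , _)) ; (inj₂ (_ , ())) }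
  F²₁← niInf v = in-E₄ (here (inj₂ (refl , refl))) , notE* λ { (inj₁ (() , _)) ; (inj₂ (_ , ())) }
  F²₁← piInf v = in-E₄ (there (here (inj₂ (refl , refl)))) , notE* λ { (inj₁ (() , _)) ; (inj₂ (_ , ())) }

  -- Rounds 1 … 2n-2 are the rotations σ^k (F_1).  Good collects the points on
  -- which σ^k and σ^{m-k} are mutually inverse, as image-partner requires.
  Good : Pt → Set
  Good (num x) = x < m
  Good _ = ⊤

  V₁G : ∀ p → V₁ n p → Good p
  V₁G (num x) v = v→ v
  V₁G nInf v = tt
  V₁G pInf v = tt
  V₂G : ∀ p → V₂ n p → Good p
  V₂G (num x) v = v→ v
  V₂G nInf v = tt
  V₂G pInf v = tt
  V₂G niInf v = tt
  V₂G piInf v = tt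

  rot-back : ∀ k j → k + j ≡ m → ∀ p → Good p → σ^ n j (σ^ n k p) ≡ p
  rot-back k j e (num x) g rewrite σ^-num k x g | σ^-num j ((x + k) % m) (<m (x + k)) = cong num (rot-inv x k j g e)
  rot-back k j e nInf g rewrite σ^-nI k | σ^-nI j = refl
  rot-back k j e pInf g rewrite σ^-pI k | σ^-pI j = refl
  rot-back k j e niInf g rewrite σ^-niI k | σ^-niI j = refl
  rot-back k j e piInf g rewrite σ^-piI k | σ^-piI j = refl

  rot-V₁ : ∀ k p → V₁ n p → V₁ n (σ^ n k p)
  rot-V₁ k (num x) v rewrite σ^-num k x (v→ v) = v← (<m (x + k))
  rot-V₁ k nInf v rewrite σ^-nI k = tt
  rot-V₁ k pInf v rewrite σ^-pI k = tt

  rot-V₂ : ∀ k p → V₂ n p → V₂ n (σ^ n k p)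
  rot-V₂ k (num x) v rewrite σ^-num k x (v→ v) = v← (<m (x + k))
  rot-V₂ k nInf v rewrite σ^-nI k = tt
  rot-V₂ k pInf v rewrite σ^-pI k = tt
  rot-V₂ k niInf v rewrite σ^-niI k = tt
  rot-V₂ k piInf v rewrite σ^-piI k = tt

  Lr : ℕ
  Lr = suc m

  L≡ : 2 * n ∸ 1 ≡ Lr
  L≡ = cong suc md≡
  L1≡ : 2 * n ≡ suc Lr
  L1≡ = cong (λ z → suc (suc z)) md≡
  L2≡ : 2 * n + 1 ≡ suc (suc Lr)
  L2≡ = trans (+-comm (2 * n) 1) (cong suc L1≡)

  ≢big : ∀ {r r'} → r ≤ m → m < r' → r ≢ r'
  ≢big le lt e = <-irrefl e (≤-<-trans le lt)

  F¹-rot : ∀ k → k < m → ∀ x y → F¹ n (suc k) x y ≡ img (σ^ n k) (F¹₁ n) x y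
  F¹-rot k lt x y rewrite ≡ᵇ-false (suc k) (2 * n ∸ 1) (λ e → ≢big lt ≤-refl (trans e L≡)) = refl

  F¹-last : ∀ x y → F¹ n Lr x y ≡ Flast¹ n x y
  F¹-last x y = subst (λ r → F¹ n r x y ≡ Flast¹ n x y) L≡ raw
    where raw : F¹ n (2 * n ∸ 1) x y ≡ Flast¹ n x y
          raw rewrite ≡ᵇ-true (2 * n ∸ 1) = refl

  L≢L1 : 2 * n ≢ 2 * n ∸ 1
  L≢L1 e = <-irrefl (trans (sym L≡) (trans (sym e) L1≡)) ≤-refl
  L≢L2 : 2 * n + 1 ≢ 2 * n ∸ 1
  L≢L2 e = <-irrefl (trans (sym L≡) (trans (sym e) L2≡)) (m≤n⇒m≤1+n ≤-refl)
  L1≢L2 : 2 * n + 1 ≢ 2 * n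
  L1≢L2 e = <-irrefl (trans (sym L1≡) (trans (sym e) L2≡)) ≤-refl

  F²-rot : ∀ k → k < m → ∀ x y → F² n (suc k) x y ≡ img (σ^ n k) (F²₁ n) x y
  F²-rot k lt x y rewrite ≡ᵇ-false (suc k) (2 * n ∸ 1) (λ e → ≢big lt ≤-refl (trans e L≡))
                        | ≡ᵇ-false (suc k) (2 * n) (λ e → ≢big lt (m≤n⇒m≤1+n ≤-refl) (trans e L1≡))
                        | ≡ᵇ-false (suc k) (2 * n + 1) (λ e → ≢big lt (m≤n⇒m≤1+n (m≤n⇒m≤1+n ≤-refl)) (trans e L2≡)) = refl

  F²-last : ∀ x y → F² n Lr x y ≡ Flast² n x y
  F²-last x y = subst (λ r → F² n r x y ≡ Flast² n x y) L≡ raw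
    where raw : F² n (2 * n ∸ 1) x y ≡ Flast² n x y
          raw rewrite ≡ᵇ-true (2 * n ∸ 1) = refl

  TinfL1 TinfL2 : List Edge
  TinfL1 = (nInf , niInf) ∷ (pInf , piInf) ∷ []
  TinfL2 = (nInf , piInf) ∷ (pInf , niInf) ∷ []

  F²-T1 : ∀ x y → F² n (suc Lr) x y ≡ (T₁ n ∪ ⟦ TinfL1 ⟧) x y
  F²-T1 x y = subst (λ r → F² n r x y ≡ (T₁ n ∪ ⟦ TinfL1 ⟧) x y) L1≡ raw
    where raw : F² n (2 * n) x y ≡ (T₁ n ∪ ⟦ TinfL1 ⟧) x y
          raw rewrite ≡ᵇ-false (2 * n) (2 * n ∸ 1) L≢L1 | ≡ᵇ-true (2 * n) = refl

  F²-T2 : ∀ x y → F² n (suc (suc Lr)) x y ≡ (T₂ n ∪ ⟦ TinfL2 ⟧) x y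
  F²-T2 x y = subst (λ r → F² n r x y ≡ (T₂ n ∪ ⟦ TinfL2 ⟧) x y) L2≡ raw
    where raw : F² n (2 * n + 1) x y ≡ (T₂ n ∪ ⟦ TinfL2 ⟧) x y
          raw rewrite ≡ᵇ-false (2 * n + 1) (2 * n ∸ 1) L≢L2 | ≡ᵇ-false (2 * n + 1) (2 * n) L1≢L2 | ≡ᵇ-true (2 * n + 1) = refl

  -- The round of a numeric pair {x, y} in F¹: gap N + 1 (a diameter) is round
  -- 2n - 1; otherwise the pair is the rotation of the base edge with the same gap
  -- (or its complement), whose lower end gapPoint d determines the rotation.

  ρnum : ℕ → ℕ → ℕ
  ρnum x y with gap x y ≟ suc N
  ... | yes _ = Lr
  ... | no _ with gap x y ≤? N
  ...   | yes _ = suc (gap (gapPoint (gap x y)) x)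
  ...   | no _ = suc (gap (gapPoint (m ∸ gap x y)) y)

  ρnum-L : ∀ {x y} → gap x y ≡ suc N → ρnum x y ≡ Lr
  ρnum-L {x} {y} e with gap x y ≟ suc N
  ... | yes _ = refl
  ... | no ne = ⊥-elim (ne e)

  ρnum-lo : ∀ {x y} → gap x y ≢ suc N → gap x y ≤ N → ρnum x y ≡ suc (gap (gapPoint (gap x y)) x)
  ρnum-lo {x} {y} ne le with gap x y ≟ suc N
  ... | yes e = ⊥-elim (ne e)
  ... | no _ with gap x y ≤? N
  ...   | yes _ = refl
  ...   | no nle = ⊥-elim (nle le)

  ρnum-hi : ∀ {x y} → gap x y ≢ suc N → ¬ gap x y ≤ N → ρnum x y ≡ suc (gap (gapPoint (m ∸ gap x y)) y)
  ρnum-hi {x} {y} ne nle with gap x y ≟ suc N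
  ... | yes e = ⊥-elim (ne e)
  ... | no _ with gap x y ≤? N
  ...   | yes le = ⊥-elim (nle le)
  ...   | no _ = refl

  N<m : N < m
  N<m = s≤s (m≤n⇒m≤1+n (m≤m+n N N))
  sN<m : suc N < m
  sN<m = s≤s (s≤s (m≤m+n N N))

  m∸suc<m : ∀ c → m ∸ suc c < m
  m∸suc<m c = s≤s (m∸n≤m M1 c)

  m∸e-big : ∀ {e} → e ≤ N → suc N < m ∸ e
  m∸e-big {e} le = m+n≤o⇒m≤o∸n (suc (suc N)) (s≤s (s≤s (+-monoʳ-≤ N le)))

  -- Rotating a base edge {a, a + d} (1 ≤ d ≤ N) by k gives an edge whose end
  -- x = a + k sees its partner at gap d; ρnum recovers k because gapPoint d = a.
  round-of-rising-edge : ∀ {a k x c} → Base a → mirror a ≡ a + suc c → k < m → x < m → a + k ≋ x → ρnum x ((mirror a + k) % m) ≡ suc k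
  round-of-rising-edge {a} {k} {x} {c} ba eq k<m x<m ax = begin
      ρnum x y                         ≡⟨ ρnum-lo {x} {y} ne (subst (_≤ N) (sym dxy) le) ⟩
      suc (gap (gapPoint (gap x y)) x) ≡⟨ cong (λ z → suc (gap (gapPoint z) x)) dxy ⟩
      suc (gap (gapPoint (suc c)) x)   ≡⟨ cong (λ z → suc (gap z x)) (gapPoint-unique ba eq (s≤s z≤n) le) ⟩
      suc (gap a x)                    ≡⟨ cong suc (gap-unique (base< (proj₁ ba)) k<m ax) ⟩
      suc k                            ∎
    where
    open ≡-Reasoning
    y = (mirror a + k) % m
    le : suc c ≤ N
    le = +-cancelˡ-≤ a (suc c) N (subst (_≤ a + N) eq (mirror-bound ba))
    dxy : gap x y ≡ suc c
    dxy = gap-unique x<m (≤-<-trans le N<m) (≋-trans (≋+ʳ (suc c) (≋-sym ax))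
            (≋-trans (≡⇒≋ (trans (+-assoc a k (suc c)) (trans (cong (a +_) (+-comm k (suc c))) (trans (sym (+-assoc a (suc c) k)) (cong (_+ k) (sym eq))))))
              (≋-sym (%≋ (mirror a + k)))))
    ne : gap x y ≢ suc N
    ne e = <-irrefl refl (subst (_≤ N) (trans (sym dxy) e) le)

  -- Seen from the upper end x = a + d + k, the partner of the same rotated edge
  -- sits at gap m - d, and ρnum again recovers k from the other end.
  round-of-falling-edge : ∀ {b k x c} → Base b → mirror b ≡ b + suc c → k < m → x < m → mirror b + k ≋ x → ρnum x ((b + k) % m) ≡ suc k
  round-of-falling-edge {b} {k} {x} {c} bb eqb k<m x<m ax = begin
      ρnum x y                               ≡⟨ ρnum-hi {x} {y} ne nle ⟩
      suc (gap (gapPoint (m ∸ gap x y)) y)   ≡⟨ cong (λ z → suc (gap (gapPoint (m ∸ z)) y)) dxy ⟩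
      suc (gap (gapPoint (m ∸ (m ∸ suc c))) y) ≡⟨ cong (λ z → suc (gap (gapPoint z) y)) (m∸[m∸n]≡n (≤-trans le (<⇒≤ N<m))) ⟩
      suc (gap (gapPoint (suc c)) y)         ≡⟨ cong (λ z → suc (gap z y)) (gapPoint-unique bb eqb (s≤s z≤n) le) ⟩
      suc (gap b y)                          ≡⟨ cong suc (gap-unique (base< (proj₁ bb)) k<m (≋-sym (%≋ (b + k)))) ⟩
      suc k                                  ∎
    where
    open ≡-Reasoning
    y = (b + k) % m
    le : suc c ≤ N
    le = +-cancelˡ-≤ b (suc c) N (subst (_≤ b + N) eqb (mirror-bound bb))
    lem : ∀ b e k Z → b + e + k + Z ≡ b + k + (e + Z)
    lem = solve-∀
    dxy : gap x y ≡ m ∸ suc c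
    dxy = gap-unique x<m (m∸suc<m c) (≋-trans (≋+ʳ (m ∸ suc c) (≋-sym ax))
            (≋-trans (≡⇒≋ (trans (cong (λ z → z + k + (m ∸ suc c)) eqb) (trans (lem b (suc c) k (m ∸ suc c))
                (cong (b + k +_) (m+[n∸m]≡n (≤-trans le (<⇒≤ N<m)))))))
              (≋-trans (+m≋ (b + k)) (≋-sym (%≋ (b + k))))))
    ne : gap x y ≢ suc N
    ne e = <-irrefl (trans (sym e) dxy) (m∸e-big le)
    nle : ¬ gap x y ≤ N
    nle l = <⇒≱ (m∸e-big le) (≤-trans (subst (_≤ N) dxy l) (n≤1+n N))

  round-of-base-edge : ∀ {a k x} → Base a → k < m → x < m → a + k ≋ x → ρnum x ((mirror a + k) % m) ≡ suc k
  round-of-base-edge {a} {k} {x} ba k<m x<m ax with mirror-involution ba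
  ... | bb , inv , neq with <-cmp a (mirror a)
  ... | tri≈ _ e _ = ⊥-elim (neq (sym e))
  ... | tri< lt _ _ = round-of-rising-edge ba (proj₂ (lt-wit lt)) k<m x<m ax
  ... | tri> _ _ gt = round-of-falling-edge bb (trans inv (proj₂ (lt-wit gt))) k<m x<m (subst (λ z → z + k ≋ x) (sym inv) ax)

  RotatedBaseEdge : ℕ → ℕ → Set
  RotatedBaseEdge x y = Σ ℕ λ a → Σ ℕ λ k → Base a × k < m × ρnum x y ≡ suc k × a + k ≋ x × mirror a + k ≋ y

  -- a short gap d ≤ N: x itself is the rotated point gapPoint d
  short-gap-edge : ∀ {x y} → x < m → y < m → x ≢ y → gap x y ≢ suc N → gap x y ≤ N → RotatedBaseEdge x y
  short-gap-edge {x} {y} x<m y<m xy ne le = a , gap a x , ba , <m (x + (m ∸ a)) , ρnum-lo {x} {y} ne le , gap-spec x (base< (proj₁ ba)) ,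
      ≋-trans (≡⇒≋ (trans (cong (_+ gap a x) eq) (trans (+-assoc a d (gap a x)) (trans (cong (a +_) (+-comm d (gap a x))) (sym (+-assoc a (gap a x) d))))))
        (≋-trans (≋+ʳ d (gap-spec x (base< (proj₁ ba)))) (gap-spec y x<m))
    where
    d = gap x y
    d≥1 : 1 ≤ d
    d≥1 = ≤∧≢⇒< z≤n (λ e → xy (uniq x<m y<m (≋-trans (≡⇒≋ (sym (trans (cong (x +_) (sym e)) (+-identityʳ x)))) (gap-spec y x<m))))
    a = gapPoint d
    ba = proj₁ (gapPoint-spec d≥1 le)
    eq : mirror a ≡ a + d
    eq = proj₂ (gapPoint-spec d≥1 le)

  -- a long gap d ≥ N + 2: y is the rotated point gapPoint (m - d), x its mirror
  long-gap-edge : ∀ {x y} → x < m → gap x y ≢ suc N → ¬ gap x y ≤ N → RotatedBaseEdge x y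
  long-gap-edge {x} {y} x<m ne nle = a , k , ba , <m (y + (m ∸ a₀)) , ρnum-hi {x} {y} ne nle , ax , subst (λ z → z + k ≋ y) (sym inv) (gap-spec y (base< (proj₁ ba₀)))
    where
    d = gap x y
    d<m : d < m
    d<m = <m (y + (m ∸ x))
    e = m ∸ d
    e≥1 : 1 ≤ e
    e≥1 = m+n≤o⇒m≤o∸n 1 d<m
    e≤N : e ≤ N
    e≤N = subst (e ≤_) (m+n∸m≡n N N) (∸-monoʳ-≤ m (≤∧≢⇒< (≰⇒> nle) (λ q → ne (sym q))))
    a₀ = gapPoint e
    ba₀ = proj₁ (gapPoint-spec e≥1 e≤N)
    eq₀ : mirror a₀ ≡ a₀ + e
    eq₀ = proj₂ (gapPoint-spec e≥1 e≤N)
    a = mirror a₀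
    ba = proj₁ (mirror-involution ba₀)
    inv : mirror a ≡ a₀
    inv = proj₁ (proj₂ (mirror-involution ba₀))
    k = gap a₀ y
    lem : ∀ a e k d → a + e + k + d ≡ a + k + (e + d)
    lem = solve-∀
    ax : a + k ≋ x
    ax = cancelʳ d (≋-trans (≡⇒≋ (trans (cong (λ z → z + k + d) eq₀) (trans (lem a₀ e k d) (cong (a₀ + k +_) (m∸n+n≡m (<⇒≤ d<m))))))
           (≋-trans (+m≋ (a₀ + k)) (≋-trans (gap-spec y (base< (proj₁ ba₀))) (≋-sym (gap-spec y x<m)))))

  base-edge-of-round : ∀ {x y} → x < m → y < m → x ≢ y → gap x y ≢ suc N → RotatedBaseEdge x y
  base-edge-of-round {x} {y} x<m y<m xy ne with gap x y ≤? N
  ... | yes le = short-gap-edge x<m y<m xy ne le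
  ... | no nle = long-gap-edge x<m ne nle

  πL : Pt → Pt
  πL (num x) = num ((x + suc N) % m)
  πL nInf = pInf
  πL pInf = nInf
  πL niInf = piInf
  πL piInf = niInf

  lastL : List Edge
  lastL = map (λ x → (num x , num (x + (n ∸ 1)))) (fromTo 0 (n ∸ 2))

  x+sN<m : ∀ {x} → x ≤ N → x + suc N < m
  x+sN<m {x} le = subst (_≤ m) (sym (cong suc (+-suc x N))) (s≤s (s≤s (+-monoˡ-≤ N le)))

  Flast→ : ∀ a b → Flast¹ n a b → V₁ n a × b ≡ πL a
  Flast→ a b p with AnyP.++⁻ lastL p
  ... | inj₂ (here (inj₁ (refl , refl))) = tt , refl
  ... | inj₂ (here (inj₂ (refl , refl))) = tt , refl
  ... | inj₁ q with anyFT→ 0 N (AnyP.map⁻ q)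
  ...   | x , _ , le , inj₁ (refl , refl) = v← (≤-<-trans le N<m) , cong num (sym (small (x+sN<m le)))
  ...   | x , _ , le , inj₂ (refl , refl) = v← (x+sN<m le) , cong num (sym (mod≡ (≤-<-trans le N<m)
             (≋-trans (≡⇒≋ (trans (+-assoc x (suc N) (suc N)) (cong (x +_) (lem N)))) (+m≋ x))))
    where lem : ∀ N → suc N + suc N ≡ suc (suc (N + N))
          lem = solve-∀

  Flast← : ∀ a → V₁ n a → Flast¹ n a (πL a)
  Flast← (num x) v with x ≤? N
  ... | yes le = AnyP.++⁺ˡ (AnyP.map⁺ (anyFT← 0 N x z≤n le (inj₁ (refl , cong num (sym (small (x+sN<m le)))))))
  ... | no nle = AnyP.++⁺ˡ (AnyP.map⁺ (anyFT← 0 N y z≤n yle (inj₂ (cong num (sym ye) , cong num (m∸n+n≡m sN≤x)))))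
    where
    sN≤x : suc N ≤ x
    sN≤x = ≰⇒> nle
    y = x ∸ suc N
    yle : y ≤ N
    yle = +-cancelʳ-≤ (suc N) y N (subst (_≤ N + suc N) (sym (m∸n+n≡m sN≤x)) (subst (x ≤_) (sym (+-suc N N)) (≤-pred (v→ v))))
    lem : ∀ y N → y + suc N + suc N ≡ y + suc (suc (N + N))
    lem = solve-∀
    ye : (x + suc N) % m ≡ y
    ye = mod≡ (≤-<-trans yle N<m) (≋-trans (≡⇒≋ (trans (cong (_+ suc N) (sym (m∸n+n≡m sN≤x))) (lem y N))) (+m≋ y))
  Flast← nInf v = AnyP.++⁺ʳ lastL (here (inj₁ (refl , refl)))
  Flast← pInf v = AnyP.++⁺ʳ lastL (here (inj₂ (refl , refl)))

  π¹ : ℕ → Pt → Pt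
  π¹ r x = if r ≡ᵇ Lr then πL x else σ^ n (r ∸ 1) (β¹ (σ^ n (m ∸ (r ∸ 1)) x))

  π¹-rot : ∀ k x → k < m → π¹ (suc k) x ≡ σ^ n k (β¹ (σ^ n (m ∸ k) x))
  π¹-rot k x lt rewrite ≡ᵇ-false (suc k) Lr (≢big lt ≤-refl) = refl

  π¹-L : ∀ x → π¹ Lr x ≡ πL x
  π¹-L x rewrite ≡ᵇ-true Lr = refl

  -- round of the pair {x, y} in F¹ (0 on pairs outside K_{2n})
  ρ¹ : Pt → Pt → ℕ
  ρ¹ (num x) (num y) = ρnum x y
  ρ¹ (num x) nInf = suc (gap h x)
  ρ¹ (num x) pInf = suc (gap M1 x)
  ρ¹ nInf (num y) = suc (gap h y)
  ρ¹ pInf (num y) = suc (gap M1 y)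
  ρ¹ nInf pInf = Lr
  ρ¹ pInf nInf = Lr
  ρ¹ _ _ = 0

  data RoundCase (r : ℕ) : Set where
    rot : ∀ k → k < m → r ≡ suc k → RoundCase r
    lst : r ≡ Lr → RoundCase r

  roundCase : ∀ {r} → 1 ≤ r → r ≤ Lr → RoundCase r
  roundCase {suc k} _ le with m≤n⇒m<n∨m≡n le
  ... | inj₁ lt = rot k (≤-pred lt) refl
  ... | inj₂ e = lst e

  back : ∀ {x k a} → k < m → x < m → a < m → a + k ≋ x → σ^ n (m ∸ k) (num x) ≡ num a
  back {x} {k} {a} k<m x<m a<m ak = trans (σ^-num (m ∸ k) x x<m) (cong num (mod≡ a<m
     (≋-trans (≋+ʳ (m ∸ k) (≋-sym ak)) (≋-trans (≡⇒≋ (trans (+-assoc a k (m ∸ k)) (cong (a +_) (m+[n∸m]≡n {k} (<⇒≤ k<m))))) (+m≋ a)))))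

  fwd : ∀ {a k y} → a < m → y < m → a + k ≋ y → σ^ n k (num a) ≡ num y
  fwd {a} {k} a<m y<m e = trans (σ^-num k a a<m) (cong num (mod≡ y<m e))

  rotPartner : (Pt → Pt) → ℕ → Pt → Pt
  rotPartner β k x = σ^ n k (β (σ^ n (m ∸ k) x))

  toward-∞ : ∀ β {c p} → c < m → β (num c) ≡ p → (∀ k → σ^ n k p ≡ p) → ∀ {x} → x < m → rotPartner β (gap c x) (num x) ≡ p
  toward-∞ β {c} c<m βc fix {x} x<m = trans (cong (λ z → σ^ n (gap c x) (β z)) (back (<m (x + (m ∸ c))) x<m c<m (gap-spec x c<m)))
      (trans (cong (σ^ n (gap c x)) βc) (fix (gap c x)))

  from-∞ : ∀ β {c p} → c < m → β p ≡ num c → (∀ k → σ^ n k p ≡ p) → ∀ {y} → y < m → rotPartner β (gap c y) p ≡ num y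
  from-∞ β {c} c<m βp fix {y} y<m = trans (cong (λ z → σ^ n (gap c y) (β z)) (fix (m ∸ gap c y)))
      (trans (cong (σ^ n (gap c y)) βp) (fwd c<m y<m (gap-spec y c<m)))

  rotated-base : ∀ β {a k x y} → β (num a) ≡ num (mirror a) → Base a → k < m → x < m → y < m → a + k ≋ x → mirror a + k ≋ y
    → rotPartner β k (num x) ≡ num y
  rotated-base β {a} {k} βa ba k<m x<m y<m ax by = trans (cong (λ z → σ^ n k (β z)) (back k<m x<m (base< (proj₁ ba)) ax))
      (trans (cong (σ^ n k) βa) (fwd (base< (proj₁ (proj₁ (mirror-involution ba)))) y<m by))

  back-spec : ∀ {x k} → k < m → (x + (m ∸ k)) % m + k ≋ x
  back-spec {x} {k} lt = ≋-trans (≋+ʳ k (%≋ (x + (m ∸ k)))) (≋-trans (≡⇒≋ (trans (+-assoc x (m ∸ k) k) (cong (x +_) (m∸n+n≡m (<⇒≤ lt))))) (+m≋ x))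

  data RotRes (k x : ℕ) : Pt → Set where
    rH : h + k ≋ x → RotRes k x nInf
    rM : M1 + k ≋ x → RotRes k x pInf
    rB : ∀ a → Base a → a + k ≋ x → RotRes k x (num ((mirror a + k) % m))

  rotRes : ∀ k x → k < m → x < m → RotRes k x (σ^ n k (β¹ (σ^ n (m ∸ k) (num x))))
  rotRes k x lt x<m = subst (λ z → RotRes k x (σ^ n k (β¹ z))) (sym (σ^-num (m ∸ k) x x<m)) (go (numberView a (<m (x + (m ∸ k)))))
    where
    a = (x + (m ∸ k)) % m
    spec : a + k ≋ x
    spec = back-spec lt
    go : NumberView a → RotRes k x (σ^ n k (β¹ (num a)))
    go (isH e) = subst (λ z → RotRes k x (σ^ n k (β¹ (num z)))) (sym e)
                   (subst (RotRes k x) (sym (trans (cong (σ^ n k) β¹-h) (σ^-nI k))) (rH (subst (λ z → z + k ≋ x) e spec)))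
    go (isM1 e) = subst (λ z → RotRes k x (σ^ n k (β¹ (num z)))) (sym e)
                   (subst (RotRes k x) (sym (trans (cong (σ^ n k) β¹-M1) (σ^-pI k))) (rM (subst (λ z → z + k ≋ x) e spec)))
    go (isB ba) = subst (RotRes k x) (sym (trans (cong (σ^ n k) (β¹-base ba)) (σ^-num k (mirror a) (base< (proj₁ (proj₁ (mirror-involution ba)))))))
                   (rB a ba spec)

  h<m : h < m
  h<m = base< h≤

  imgF¹ : ∀ k → k < m → GraphOf (V₁ n) (img (σ^ n k) (F¹₁ n)) (λ x → σ^ n k (β¹ (σ^ n (m ∸ k) x)))
  imgF¹ k lt = image-partner (V₁ n) (σ^ n k) (σ^ n (m ∸ k)) (F¹₁ n) β¹
      (λ a v → rot-back k (m ∸ k) (m+[n∸m]≡n (<⇒≤ lt)) a (V₁G a v))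
      (λ x v → rot-back (m ∸ k) k (m∸n+n≡m (<⇒≤ lt)) x (V₁G x v))
      (λ a v → rot-V₁ k a v) (λ x v → rot-V₁ (m ∸ k) x v) (F¹₁→ , F¹₁←)

  F¹⇒π¹ : ∀ r → 1 ≤ r → r ≤ 2 * n ∸ 1 → ∀ x y → F¹ n r x y → V₁ n x × y ≡ π¹ r x
  F¹⇒π¹ r p q x y f with roundCase p (subst (r ≤_) L≡ q)
  ... | rot k lt refl = let (v , e) = proj₁ (imgF¹ k lt) x y (subst id (F¹-rot k lt x y) f) in v , trans e (sym (π¹-rot k x lt))
  ... | lst refl = let (v , e) = Flast→ x y (subst id (F¹-last x y) f) in v , trans e (sym (π¹-L x))

  π¹∈F¹ : ∀ r → 1 ≤ r → r ≤ 2 * n ∸ 1 → ∀ x → V₁ n x → F¹ n r x (π¹ r x)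
  π¹∈F¹ r p q x v with roundCase p (subst (r ≤_) L≡ q)
  ... | rot k lt refl = subst id (sym (F¹-rot k lt x (π¹ (suc k) x))) (subst (img (σ^ n k) (F¹₁ n) x) (sym (π¹-rot k x lt)) (proj₂ (imgF¹ k lt) x v))
  ... | lst refl = subst id (sym (F¹-last x (π¹ Lr x))) (subst (Flast¹ n x) (sym (π¹-L x)) (Flast← x v))

  β¹-V : ∀ a → V₁ n a → V₁ n (β¹ a)
  β¹-V (num a) v with numberView a (v→ v)
  ... | isH refl = subst (V₁ n) (sym β¹-h) tt
  ... | isM1 refl = subst (V₁ n) (sym β¹-M1) tt
  ... | isB ba = subst (V₁ n) (sym (β¹-base ba)) (v← (base< (proj₁ (proj₁ (mirror-involution ba)))))
  β¹-V nInf v = v← h<m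
  β¹-V pInf v = v← M1<m

  -- a rotated base edge is never a loop, since mirror has no fixed points on Base
  num≢ : ∀ {a k x} → Base a → a + k ≋ x → x < m → num ((mirror a + k) % m) ≢ num x
  num≢ {a} {k} {x} ba ak x<m e = proj₂ (proj₂ (mirror-involution ba))
     (uniq (base< (proj₁ (proj₁ (mirror-involution ba)))) (base< (proj₁ ba)) (cancelʳ k (≋-trans (≋-sym (%≋ (mirror a + k))) (≋-trans (≡⇒≋ (num-inj e)) (≋-sym ak)))))

  π¹-valid : ∀ r → 1 ≤ r → r ≤ 2 * n ∸ 1 → ∀ x → V₁ n x → V₁ n (π¹ r x) × π¹ r x ≢ x
  π¹-valid r p q x v with roundCase p (subst (r ≤_) L≡ q)
  ... | rot k lt refl rewrite π¹-rot k x lt = rot-V₁ k _ (β¹-V _ (rot-V₁ (m ∸ k) x v)) , ne x v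
    where
    ne : ∀ x → V₁ n x → σ^ n k (β¹ (σ^ n (m ∸ k) x)) ≢ x
    ne (num x) v with σ^ n k (β¹ (σ^ n (m ∸ k) (num x))) | rotRes k x lt (v→ v)
    ... | .nInf | rH _ = λ ()
    ... | .pInf | rM _ = λ ()
    ... | ._ | rB a ba ak = num≢ ba ak (v→ v)
    ne nInf v rewrite σ^-nI (m ∸ k) | σ^-num k h h<m = λ ()
    ne pInf v rewrite σ^-pI (m ∸ k) | σ^-num k M1 M1<m = λ ()
  ... | lst refl rewrite π¹-L x = vL x v , neL x v
    where
    vL : ∀ x → V₁ n x → V₁ n (πL x)
    vL (num x) v = v← (<m (x + suc N))
    vL nInf v = tt
    vL pInf v = tt
    neL : ∀ x → V₁ n x → πL x ≢ x
    neL (num x) v e = step≢ (v→ v) (s≤s z≤n) sN<m (num-inj e)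
    neL nInf v ()
    neL pInf v ()

  inR : ∀ {k} → k < m → 1 ≤ suc k × suc k ≤ 2 * n ∸ 1
  inR {k} lt = s≤s z≤n , subst (suc k ≤_) (sym L≡) (m≤n⇒m≤1+n lt)
  rot¹ : ∀ {k x y} → k < m → rotPartner β¹ k x ≡ y → 1 ≤ suc k × suc k ≤ 2 * n ∸ 1 × π¹ (suc k) x ≡ y
  rot¹ {k} {x} k<m e = proj₁ (inR k<m) , proj₂ (inR k<m) , trans (π¹-rot k x k<m) e

  LinR : 1 ≤ Lr × Lr ≤ 2 * n ∸ 1
  LinR = s≤s z≤n , ≤-reflexive (sym L≡)

  ρ¹-of-π¹ : ∀ r → 1 ≤ r → r ≤ 2 * n ∸ 1 → ∀ x → V₁ n x → ρ¹ x (π¹ r x) ≡ r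
  ρ¹-of-π¹ r p q x v with roundCase p (subst (r ≤_) L≡ q)
  ... | rot k lt refl rewrite π¹-rot k x lt = go x v
    where
    go : ∀ x → V₁ n x → ρ¹ x (σ^ n k (β¹ (σ^ n (m ∸ k) x))) ≡ suc k
    go (num x) v with σ^ n k (β¹ (σ^ n (m ∸ k) (num x))) | rotRes k x lt (v→ v)
    ... | .nInf | rH e = cong suc (gap-unique h<m lt e)
    ... | .pInf | rM e = cong suc (gap-unique M1<m lt e)
    ... | ._ | rB a ba ak = round-of-base-edge ba lt (v→ v) ak
    go nInf v rewrite σ^-nI (m ∸ k) | σ^-num k h h<m = cong suc (gap-unique h<m lt (≋-sym (%≋ (h + k))))
    go pInf v rewrite σ^-pI (m ∸ k) | σ^-num k M1 M1<m = cong suc (gap-unique M1<m lt (≋-sym (%≋ (M1 + k))))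
  ... | lst refl rewrite π¹-L x = go x v
    where
    go : ∀ x → V₁ n x → ρ¹ x (πL x) ≡ Lr
    go (num x) v = ρnum-L {x} {(x + suc N) % m} (gap-unique (v→ v) sN<m (≋-sym (%≋ (x + suc N))))
    go nInf v = refl
    go pInf v = refl

  diameter? : ∀ x y → (gap x y ≡ suc N) ⊎ (gap x y ≢ suc N)
  diameter? x y with gap x y ≟ suc N
  ... | yes e = inj₁ e
  ... | no ne = inj₂ ne

  π¹-of-ρ¹ : ∀ x y → V₁ n x → V₁ n y → x ≢ y → 1 ≤ ρ¹ x y × ρ¹ x y ≤ 2 * n ∸ 1 × π¹ (ρ¹ x y) x ≡ y
  π¹-of-ρ¹ (num x) (num y) vx vy ne with diameter? x y
  ... | inj₁ e = subst (λ r → 1 ≤ r × r ≤ 2 * n ∸ 1 × π¹ r (num x) ≡ num y) (sym (ρnum-L {x} {y} e))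
                  (proj₁ LinR , proj₂ LinR , trans (π¹-L (num x)) (cong num (mod≡ (v→ vy) (subst (λ z → x + z ≋ y) e (gap-spec y (v→ vx))))))
  ... | inj₂ ne' with base-edge-of-round (v→ vx) (v→ vy) (λ e → ne (cong num e)) ne'
  ...   | a , k , ba , k<m , ρeq , ax , by = subst (λ r → 1 ≤ r × r ≤ 2 * n ∸ 1 × π¹ r (num x) ≡ num y) (sym ρeq)
            (rot¹ k<m (rotated-base β¹ (β¹-base ba) ba k<m (v→ vx) (v→ vy) ax by))
  π¹-of-ρ¹ (num x) nInf vx vy ne = rot¹ (<m (x + (m ∸ h))) (toward-∞ β¹ h<m β¹-h σ^-nI (v→ vx))
  π¹-of-ρ¹ (num x) pInf vx vy ne = rot¹ (<m (x + (m ∸ M1))) (toward-∞ β¹ M1<m β¹-M1 σ^-pI (v→ vx))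
  π¹-of-ρ¹ nInf (num y) vx vy ne = rot¹ (<m (y + (m ∸ h))) (from-∞ β¹ h<m refl σ^-nI (v→ vy))
  π¹-of-ρ¹ pInf (num y) vx vy ne = rot¹ (<m (y + (m ∸ M1))) (from-∞ β¹ M1<m refl σ^-pI (v→ vy))
  π¹-of-ρ¹ nInf pInf vx vy ne = proj₁ LinR , proj₂ LinR , π¹-L nInf
  π¹-of-ρ¹ pInf nInf vx vy ne = proj₁ LinR , proj₂ LinR , π¹-L pInf
  π¹-of-ρ¹ nInf nInf vx vy ne = ⊥-elim (ne refl)
  π¹-of-ρ¹ pInf pInf vx vy ne = ⊥-elim (ne refl)

  module G1 = OneFactorisationCriterion (V₁ n) (2 * n ∸ 1) (F¹ n) π¹ ρ¹ F¹⇒π¹ π¹∈F¹ π¹-valid ρ¹-of-π¹ π¹-of-ρ¹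

  -- Rounds 2n and 2n + 1 of F²: T₁ = {σ^{2j} e*} matches x with x + 1 when its
  -- offset x - e0 is even and with x - 1 otherwise; T₂ = σ(T₁) does the opposite.

  e0<m : e0 < m
  e0<m = base< (proj₁ e0-isBase)
  e1<m : e1 < m
  e1<m = base< (proj₁ e1-isBase)

  offset : ℕ → ℕ
  offset x = gap e0 x

  πT1 : Pt → Pt
  πT1 (num x) = if ev (offset x) then num ((x + 1) % m) else num ((x + M1) % m)
  πT1 nInf = niInf
  πT1 niInf = nInf
  πT1 pInf = piInf
  πT1 piInf = pInf

  πT2 : Pt → Pt
  πT2 (num x) = if ev (offset x) then num ((x + M1) % m) else num ((x + 1) % m)
  πT2 nInf = piInf
  πT2 piInf = nInf
  πT2 pInf = niInf
  πT2 niInf = pInf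

  πT1-ev : ∀ {x} → ev (offset x) ≡ true → πT1 (num x) ≡ num ((x + 1) % m)
  πT1-ev {x} e rewrite e = refl
  πT1-od : ∀ {x} → ev (offset x) ≡ false → πT1 (num x) ≡ num ((x + M1) % m)
  πT1-od {x} e rewrite e = refl
  πT2-ev : ∀ {x} → ev (offset x) ≡ true → πT2 (num x) ≡ num ((x + M1) % m)
  πT2-ev {x} e rewrite e = refl
  πT2-od : ∀ {x} → ev (offset x) ≡ false → πT2 (num x) ≡ num ((x + 1) % m)
  πT2-od {x} e rewrite e = refl

  ev-M1 : ev M1 ≡ false
  ev-M1 = ev-double1 N

  -- successive residues modulo the even number m alternate in parity, also across m - 1 ↦ 0
  parity-flip : ∀ {c c'} → c < m → c' < m → c' + 1 ≋ c → ev c ≡ not (ev c')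
  parity-flip {c} {c'} c<m c'<m e with m≤n⇒m<n∨m≡n c'<m
  ... | inj₁ lt = trans (cong ev (sym (uniq (subst (_< m) (+-comm 1 c') lt) c<m e))) (trans (cong ev (+-comm c' 1)) (ev-suc c'))
  ... | inj₂ eq = trans (cong ev c0) (cong not (sym (trans (cong ev (suc-injective eq)) ev-M1)))
    where c0 : c ≡ 0
          c0 = sym (uniq (s≤s z≤n) c<m (≋-trans (≋-sym (+m≋ 0)) (≋-trans (≡⇒≋ (trans (sym eq) (+-comm 1 c'))) e)))

  offset<m : ∀ x → offset x < m
  offset<m x = <m (x + (m ∸ e0))

  offset-step : ∀ {x y} → x < m → y < m → y + 1 ≋ x → ev (offset x) ≡ not (ev (offset y))
  offset-step {x} {y} x<m y<m e = parity-flip (offset<m x) (offset<m y) (cancelˡ e0 (≋-trans (≡⇒≋ (sym (+-assoc e0 (offset y) 1)))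
      (≋-trans (≋+ʳ 1 (gap-spec y e0<m)) (≋-trans e (≋-sym (gap-spec x e0<m))))))

  2j≡ : ∀ j → 2 * j ≡ j + j
  2j≡ j = cong (j +_) (+-identityʳ j)

  T₁-elems : ∀ j → mapE (σ^ n (2 * j)) (e* n) ≡ (num ((e0 + 2 * j) % m) , num ((e1 + 2 * j) % m))
  T₁-elems j rewrite e*≡ | σ^-num (2 * j) e0 e0<m | σ^-num (2 * j) e1 e1<m = refl

  PN : Pt → Set
  PN (num x) = x < m
  PN _ = ⊥

  jbound : ∀ {j} → j ≤ N → 2 * j < m
  jbound {j} le = subst (_< m) (sym (2j≡ j)) (s≤s (m≤n⇒m≤1+n (+-mono-≤ le le)))

  jbound' : ∀ {j} → j ≤ N → suc (2 * j) < m
  jbound' {j} le = subst (λ z → suc z < m) (sym (2j≡ j)) (s≤s (s≤s (+-mono-≤ le le)))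

  T₁→ : ∀ x y → T₁ n x y → PN x × y ≡ πT1 x
  T₁→ x y (j , jle , sm) with subst (λ E → Same E (x , y)) (T₁-elems j) sm
  ... | inj₁ (refl , refl) = <m (e0 + 2 * j) , sym (trans (πT1-ev {z} evc) (cong num (mod≡ (<m (e1 + 2 * j))
          (≋-trans (≋+ʳ 1 (%≋ (e0 + 2 * j))) (≋-trans (≡⇒≋ (+-comm (e0 + 2 * j) 1)) (≋-sym (%≋ (e1 + 2 * j))))))))
    where
    z = (e0 + 2 * j) % m
    cz : offset z ≡ 2 * j
    cz = gap-unique e0<m (jbound jle) (≋-sym (%≋ (e0 + 2 * j)))
    evc : ev (offset z) ≡ true
    evc = trans (cong ev (trans cz (2j≡ j))) (ev-double j)
  ... | inj₂ (refl , refl) = <m (e1 + 2 * j) , sym (trans (πT1-od {z} odc) (cong num (mod≡ (<m (e0 + 2 * j))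
          (≋-trans (≋+ʳ M1 (%≋ (e1 + 2 * j))) (≋-trans (≡⇒≋ (lem e0 (2 * j) N)) (≋-trans (+m≋ (e0 + 2 * j)) (≋-sym (%≋ (e0 + 2 * j)))))))))
    where
    lem : ∀ e t N → suc e + t + suc (N + N) ≡ e + t + suc (suc (N + N))
    lem = solve-∀
    z = (e1 + 2 * j) % m
    cz : offset z ≡ suc (2 * j)
    cz = gap-unique e0<m (jbound' jle) (≋-trans (≡⇒≋ (+-suc e0 (2 * j))) (≋-sym (%≋ (e1 + 2 * j))))
    odc : ev (offset z) ≡ false
    odc = trans (cong ev (trans cz (cong suc (2j≡ j)))) (ev-double1 j)

  half≤ : ∀ {j c} → c < m → (c ≡ j + j ⊎ c ≡ suc (j + j)) → j ≤ N
  half≤ {j} c<m eq = ≮⇒≥ λ big → <⇒≱ c<m (≤-trans (≤-reflexive (cong suc (sym (+-suc N N)))) (≤-trans (+-mono-≤ big big) (lem eq)))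
    where
    lem : ∀ {c} → (c ≡ j + j ⊎ c ≡ suc (j + j)) → j + j ≤ c
    lem (inj₁ e) = ≤-reflexive (sym e)
    lem (inj₂ e) = ≤-trans (n≤1+n _) (≤-reflexive (sym e))

  T₁← : ∀ x → x < m → T₁ n (num x) (πT1 (num x))
  T₁← x x<m with half-spec (offset x)
  ... | inj₁ (evc , ceq) = j , half≤ (offset<m x) (inj₁ ceq) , subst (λ E → Same E (num x , πT1 (num x))) (sym (T₁-elems j))
          (inj₁ (cong num (mod≡ x<m ex) , trans (cong num (get (≋-trans (≡⇒≋ (sym (+-comm (e0 + 2 * j) 1))) (≋+ʳ 1 ex)))) (sym (πT1-ev {x} evc))))
    where
    j = half (offset x)
    ex : e0 + 2 * j ≋ x
    ex = subst (λ z → e0 + z ≋ x) (trans ceq (sym (2j≡ j))) (gap-spec x e0<m)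
  ... | inj₂ (odc , ceq) = j , half≤ (offset<m x) (inj₂ ceq) , subst (λ E → Same E (num x , πT1 (num x))) (sym (T₁-elems j))
          (inj₂ (trans (cong num (get (≋-sym e2))) (sym (πT1-od {x} odc)) , cong num (mod≡ x<m ex)))
    where
    j = half (offset x)
    ex : e1 + 2 * j ≋ x
    ex = ≋-trans (≡⇒≋ (trans (sym (+-suc e0 (2 * j))) (cong (e0 +_) (trans (cong suc (2j≡ j)) (sym ceq))))) (gap-spec x e0<m)
    lem : ∀ e t N → suc e + t + suc (N + N) ≡ e + t + suc (suc (N + N))
    lem = solve-∀
    e2 : x + M1 ≋ e0 + 2 * j
    e2 = ≋-trans (≋+ʳ M1 (≋-sym ex)) (≋-trans (≡⇒≋ (lem e0 (2 * j) N)) (+m≋ (e0 + 2 * j)))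

  T₁←' : ∀ a → PN a → T₁ n a (πT1 a)
  T₁←' (num x) p = T₁← x p

  imgT2 : GraphOf PN (img (σ n) (T₁ n)) (λ x → σ n (πT1 (σ^ n M1 x)))
  imgT2 = image-partner PN (σ n) (σ^ n M1) (T₁ n) πT1
      (λ { (num x) p → rot-back 1 M1 refl (num x) p })
      (λ { (num x) p → rot-back M1 1 (+-comm M1 1) (num x) p })
      (λ { (num x) p → subst PN (sym (σ-num x)) (<m (suc x)) })
      (λ { (num x) p → subst PN (sym (σ^-num M1 x p)) (<m (x + M1)) })
      (T₁→ , T₁←')

  πT2-eq : ∀ x → x < m → σ n (πT1 (σ^ n M1 (num x))) ≡ πT2 (num x)
  πT2-eq x x<m = trans (cong (λ p → σ n (πT1 p)) (σ^-num M1 x x<m)) (go (ev (offset x')) refl)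
    where
    x' = (x + M1) % m
    x'1 : x' + 1 ≋ x
    x'1 = ≋-trans (≋+ʳ 1 (%≋ (x + M1))) (≋-trans (≡⇒≋ (trans (+-assoc x M1 1) (cong (x +_) (+-comm M1 1)))) (+m≋ x))
    st : ev (offset x) ≡ not (ev (offset x'))
    st = offset-step x<m (<m (x + M1)) x'1
    go : ∀ b → ev (offset x') ≡ b → σ n (πT1 (num x')) ≡ πT2 (num x)
    go true e = trans (cong (σ n) (πT1-ev {x'} e)) (trans (σ-num ((x' + 1) % m)) (trans (cong num (get
                  (≋-trans (≋+ˡ 1 (%≋ (x' + 1))) (≋-trans (≡⇒≋ (+-comm 1 (x' + 1))) (≋-trans (≋+ʳ 1 x'1) ≋-refl)))))
                  (sym (πT2-od {x} (trans st (cong not e))))))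
    go false e = trans (cong (σ n) (πT1-od {x'} e)) (trans (σ-num ((x' + M1) % m)) (trans (cong num (get
                  (≋-trans (≋+ˡ 1 (%≋ (x' + M1))) (≋-trans (≡⇒≋ (lem x' N)) (≋-trans (+m≋ x') (%≋ (x + M1)))))))
                  (sym (πT2-ev {x} (trans st (cong not e))))))
      where lem : ∀ x N → 1 + (x + suc (N + N)) ≡ x + suc (suc (N + N))
            lem = solve-∀

  -- The second family: F²₁ differs from F¹₁ by replacing e* with the edges to
  -- ±i∞, so numeric pairs of gap ±1 move to the T-rounds, the rest stay.

  β²-V : ∀ a → V₂ n a → V₂ n (β² a)
  β²-V (num a) v with e*View a
  ... | inj₁ refl = subst (V₂ n) (sym β²-e0) tt
  ... | inj₂ (inj₁ refl) = subst (V₂ n) (sym β²-e1) tt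
  ... | inj₂ (inj₂ (n0 , n1)) = subst (V₂ n) (sym (β²-oth n0 n1)) (V₁⇒V₂ (β¹ (num a)) (β¹-V (num a) v))
  β²-V nInf v = v← h<m
  β²-V pInf v = v← M1<m
  β²-V niInf v = v← e0<m
  β²-V piInf v = v← e1<m

  data RotRes2 (k x : ℕ) : Pt → Set where
    sE0 : e0 + k ≋ x → RotRes2 k x niInf
    sE1 : e1 + k ≋ x → RotRes2 k x piInf
    sH : h + k ≋ x → RotRes2 k x nInf
    sM : M1 + k ≋ x → RotRes2 k x pInf
    sB : ∀ a → Base a → a ≢ e0 → a ≢ e1 → a + k ≋ x → RotRes2 k x (num ((mirror a + k) % m))

  rotRes2 : ∀ k x → k < m → x < m → RotRes2 k x (σ^ n k (β² (σ^ n (m ∸ k) (num x))))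
  rotRes2 k x lt x<m = subst (λ z → RotRes2 k x (σ^ n k (β² z))) (sym (σ^-num (m ∸ k) x x<m)) (go (e*View a))
    where
    a = (x + (m ∸ k)) % m
    spec : a + k ≋ x
    spec = back-spec lt
    go1 : a ≢ e0 → a ≢ e1 → NumberView a → RotRes2 k x (σ^ n k (β¹ (num a)))
    go1 n0 n1 (isH e) = subst (λ z → RotRes2 k x (σ^ n k (β¹ (num z)))) (sym e)
                   (subst (RotRes2 k x) (sym (trans (cong (σ^ n k) β¹-h) (σ^-nI k))) (sH (subst (λ z → z + k ≋ x) e spec)))
    go1 n0 n1 (isM1 e) = subst (λ z → RotRes2 k x (σ^ n k (β¹ (num z)))) (sym e)
                   (subst (RotRes2 k x) (sym (trans (cong (σ^ n k) β¹-M1) (σ^-pI k))) (sM (subst (λ z → z + k ≋ x) e spec)))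
    go1 n0 n1 (isB ba) = subst (RotRes2 k x) (sym (trans (cong (σ^ n k) (β¹-base ba)) (σ^-num k (mirror a) (base< (proj₁ (proj₁ (mirror-involution ba)))))))
                   (sB a ba n0 n1 spec)
    go : E*View a → RotRes2 k x (σ^ n k (β² (num a)))
    go (inj₁ e) = subst (λ z → RotRes2 k x (σ^ n k (β² (num z)))) (sym e)
                    (subst (RotRes2 k x) (sym (trans (cong (σ^ n k) β²-e0) (σ^-niI k))) (sE0 (subst (λ z → z + k ≋ x) e spec)))
    go (inj₂ (inj₁ e)) = subst (λ z → RotRes2 k x (σ^ n k (β² (num z)))) (sym e)
                    (subst (RotRes2 k x) (sym (trans (cong (σ^ n k) β²-e1) (σ^-piI k))) (sE1 (subst (λ z → z + k ≋ x) e spec)))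
    go (inj₂ (inj₂ (n0 , n1))) = subst (λ z → RotRes2 k x (σ^ n k z)) (sym (β²-oth n0 n1)) (go1 n0 n1 (numberView a (<m (x + (m ∸ k)))))

  π² : ℕ → Pt → Pt
  π² r x = if r ≡ᵇ Lr then πL x else if r ≡ᵇ suc Lr then πT1 x else if r ≡ᵇ suc (suc Lr) then πT2 x
           else σ^ n (r ∸ 1) (β² (σ^ n (m ∸ (r ∸ 1)) x))

  π²-rot : ∀ k x → k < m → π² (suc k) x ≡ σ^ n k (β² (σ^ n (m ∸ k) x))
  π²-rot k x lt rewrite ≡ᵇ-false (suc k) Lr (≢big lt ≤-refl)
                      | ≡ᵇ-false (suc k) (suc Lr) (≢big lt (m≤n⇒m≤1+n ≤-refl))
                      | ≡ᵇ-false (suc k) (suc (suc Lr)) (≢big lt (m≤n⇒m≤1+n (m≤n⇒m≤1+n ≤-refl))) = refl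

  π²-L : ∀ x → π² Lr x ≡ πL x
  π²-L x rewrite ≡ᵇ-true Lr = refl
  π²-T1 : ∀ x → π² (suc Lr) x ≡ πT1 x
  π²-T1 x rewrite ≡ᵇ-false (suc Lr) Lr (λ e → <-irrefl (sym e) ≤-refl) | ≡ᵇ-true Lr = refl
  π²-T2 : ∀ x → π² (suc (suc Lr)) x ≡ πT2 x
  π²-T2 x rewrite ≡ᵇ-false (suc (suc Lr)) Lr (λ e → <-irrefl (sym e) (m≤n⇒m≤1+n ≤-refl)) | ≡ᵇ-false (suc Lr) Lr (λ e → <-irrefl (sym e) ≤-refl) | ≡ᵇ-true Lr = refl

  -- the T-round (2n or 2n + 1) containing the gap-1 pair {z, z + 1}
  tRound : ℕ → ℕ
  tRound z = if ev (offset z) then suc Lr else suc (suc Lr)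

  tRound-even : ∀ {z} → ev (offset z) ≡ true → tRound z ≡ suc Lr
  tRound-even e rewrite e = refl
  tRound-odd : ∀ {z} → ev (offset z) ≡ false → tRound z ≡ suc (suc Lr)
  tRound-odd e rewrite e = refl

  ρ²num : ℕ → ℕ → ℕ
  ρ²num x y with gap x y ≟ 1
  ... | yes _ = tRound x
  ... | no _ with gap x y ≟ M1
  ...   | yes _ = tRound y
  ...   | no _ = ρnum x y

  ρ²-1 : ∀ {x y} → gap x y ≡ 1 → ρ²num x y ≡ tRound x
  ρ²-1 {x} {y} e with gap x y ≟ 1
  ... | yes _ = refl
  ... | no ne = ⊥-elim (ne e)
  ρ²-M1 : ∀ {x y} → gap x y ≢ 1 → gap x y ≡ M1 → ρ²num x y ≡ tRound y
  ρ²-M1 {x} {y} n1 e with gap x y ≟ 1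
  ... | yes e' = ⊥-elim (n1 e')
  ... | no _ with gap x y ≟ M1
  ...   | yes _ = refl
  ...   | no ne = ⊥-elim (ne e)
  ρ²-oth : ∀ {x y} → gap x y ≢ 1 → gap x y ≢ M1 → ρ²num x y ≡ ρnum x y
  ρ²-oth {x} {y} n1 nM with gap x y ≟ 1
  ... | yes e' = ⊥-elim (n1 e')
  ... | no _ with gap x y ≟ M1
  ...   | yes e' = ⊥-elim (nM e')
  ...   | no _ = refl

  ρ² : Pt → Pt → ℕ
  ρ² (num x) (num y) = ρ²num x y
  ρ² (num x) niInf = suc (gap e0 x)
  ρ² (num x) piInf = suc (gap e1 x)
  ρ² niInf (num y) = suc (gap e0 y)
  ρ² piInf (num y) = suc (gap e1 y)
  ρ² nInf niInf = suc Lr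
  ρ² niInf nInf = suc Lr
  ρ² pInf piInf = suc Lr
  ρ² piInf pInf = suc Lr
  ρ² nInf piInf = suc (suc Lr)
  ρ² piInf nInf = suc (suc Lr)
  ρ² pInf niInf = suc (suc Lr)
  ρ² niInf pInf = suc (suc Lr)
  ρ² niInf piInf = Lr
  ρ² piInf niInf = Lr
  ρ² x y = ρ¹ x y

  data RoundCase² (r : ℕ) : Set where
    rot2 : ∀ k → k < m → r ≡ suc k → RoundCase² r
    lst2 : r ≡ Lr → RoundCase² r
    tt1 : r ≡ suc Lr → RoundCase² r
    tt2 : r ≡ suc (suc Lr) → RoundCase² r

  roundCase² : ∀ {r} → 1 ≤ r → r ≤ 2 * n + 1 → RoundCase² r
  roundCase² {r} p q with m≤n⇒m<n∨m≡n (subst (r ≤_) L2≡ q)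
  ... | inj₂ e = tt2 e
  ... | inj₁ lt with m≤n⇒m<n∨m≡n (≤-pred lt)
  ...   | inj₂ e = tt1 e
  ...   | inj₁ lt' with roundCase p (≤-pred lt')
  ...     | rot k l e = rot2 k l e
  ...     | lst e = lst2 e

  PN⇒V₂ : ∀ x → PN x → V₂ n x
  PN⇒V₂ (num x) p = v← p

  imgF² : ∀ k → k < m → GraphOf (V₂ n) (img (σ^ n k) (F²₁ n)) (λ x → σ^ n k (β² (σ^ n (m ∸ k) x)))
  imgF² k lt = image-partner (V₂ n) (σ^ n k) (σ^ n (m ∸ k)) (F²₁ n) β²
      (λ a v → rot-back k (m ∸ k) (m+[n∸m]≡n (<⇒≤ lt)) a (V₂G a v))
      (λ x v → rot-back (m ∸ k) k (m∸n+n≡m (<⇒≤ lt)) x (V₂G x v))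
      (λ a v → rot-V₂ k a v) (λ x v → rot-V₂ (m ∸ k) x v) (F²₁→ , F²₁←)

  F²⇒π² : ∀ r → 1 ≤ r → r ≤ 2 * n + 1 → ∀ x y → F² n r x y → V₂ n x × y ≡ π² r x
  F²⇒π² r p q x y f with roundCase² p q
  ... | rot2 k lt refl = let (v , e) = proj₁ (imgF² k lt) x y (subst id (F²-rot k lt x y) f) in v , trans e (sym (π²-rot k x lt))
  ... | lst2 refl = go (subst id (F²-last x y) f)
    where
    go : Flast² n x y → V₂ n x × y ≡ π² Lr x
    go (inj₁ g) = let (v , e) = Flast→ x y g in V₁⇒V₂ x v , trans e (sym (π²-L x))
    go (inj₂ (here (inj₁ (refl , refl)))) = tt , sym (π²-L niInf)
    go (inj₂ (here (inj₂ (refl , refl)))) = tt , sym (π²-L piInf)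
  ... | tt1 refl = go (subst id (F²-T1 x y) f)
    where
    go : (T₁ n ∪ ⟦ TinfL1 ⟧) x y → V₂ n x × y ≡ π² (suc Lr) x
    go (inj₁ g) = let (v , e) = T₁→ x y g in PN⇒V₂ x v , trans e (sym (π²-T1 x))
    go (inj₂ (here (inj₁ (refl , refl)))) = tt , sym (π²-T1 nInf)
    go (inj₂ (here (inj₂ (refl , refl)))) = tt , sym (π²-T1 niInf)
    go (inj₂ (there (here (inj₁ (refl , refl))))) = tt , sym (π²-T1 pInf)
    go (inj₂ (there (here (inj₂ (refl , refl))))) = tt , sym (π²-T1 piInf)
  ... | tt2 refl = go x y (subst id (F²-T2 x y) f)
    where
    go : ∀ x y → (T₂ n ∪ ⟦ TinfL2 ⟧) x y → V₂ n x × y ≡ π² (suc (suc Lr)) x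
    go x y (inj₁ g) with proj₁ imgT2 x y g
    go (num x') y (inj₁ g) | v , e = PN⇒V₂ (num x') v , trans e (trans (πT2-eq x' v) (sym (π²-T2 (num x'))))
    go x y (inj₂ (here (inj₁ (refl , refl)))) = tt , sym (π²-T2 nInf)
    go x y (inj₂ (here (inj₂ (refl , refl)))) = tt , sym (π²-T2 piInf)
    go x y (inj₂ (there (here (inj₁ (refl , refl))))) = tt , sym (π²-T2 pInf)
    go x y (inj₂ (there (here (inj₂ (refl , refl))))) = tt , sym (π²-T2 niInf)

  π²∈F² : ∀ r → 1 ≤ r → r ≤ 2 * n + 1 → ∀ x → V₂ n x → F² n r x (π² r x)
  π²∈F² r p q x v with roundCase² p q
  ... | rot2 k lt refl = subst id (sym (F²-rot k lt x (π² (suc k) x))) (subst (img (σ^ n k) (F²₁ n) x) (sym (π²-rot k x lt)) (proj₂ (imgF² k lt) x v))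
  ... | lst2 refl = subst id (sym (F²-last x (π² Lr x))) (subst (Flast² n x) (sym (π²-L x)) (go x v))
    where
    go : ∀ x → V₂ n x → Flast² n x (πL x)
    go (num x) v = inj₁ (Flast← (num x) v)
    go nInf v = inj₁ (Flast← nInf tt)
    go pInf v = inj₁ (Flast← pInf tt)
    go niInf v = inj₂ (here (inj₁ (refl , refl)))
    go piInf v = inj₂ (here (inj₂ (refl , refl)))
  ... | tt1 refl = subst id (sym (F²-T1 x (π² (suc Lr) x))) (subst ((T₁ n ∪ ⟦ TinfL1 ⟧) x) (sym (π²-T1 x)) (go x v))
    where
    go : ∀ x → V₂ n x → (T₁ n ∪ ⟦ TinfL1 ⟧) x (πT1 x)
    go (num x) v = inj₁ (T₁← x (v→ v))
    go nInf v = inj₂ (here (inj₁ (refl , refl)))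
    go niInf v = inj₂ (here (inj₂ (refl , refl)))
    go pInf v = inj₂ (there (here (inj₁ (refl , refl))))
    go piInf v = inj₂ (there (here (inj₂ (refl , refl))))
  ... | tt2 refl = subst id (sym (F²-T2 x (π² (suc (suc Lr)) x))) (subst ((T₂ n ∪ ⟦ TinfL2 ⟧) x) (sym (π²-T2 x)) (go x v))
    where
    go : ∀ x → V₂ n x → (T₂ n ∪ ⟦ TinfL2 ⟧) x (πT2 x)
    go (num x) v = inj₁ (subst (T₂ n (num x)) (πT2-eq x (v→ v)) (proj₂ imgT2 (num x) (v→ v)))
    go nInf v = inj₂ (here (inj₁ (refl , refl)))
    go piInf v = inj₂ (here (inj₂ (refl , refl)))
    go pInf v = inj₂ (there (here (inj₁ (refl , refl))))
    go niInf v = inj₂ (there (here (inj₂ (refl , refl))))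

  1<m : 1 < m
  1<m = s≤s (s≤s z≤n)

  rotation²-valid : ∀ k → k < m → ∀ x → V₂ n x → V₂ n (σ^ n k (β² (σ^ n (m ∸ k) x))) × σ^ n k (β² (σ^ n (m ∸ k) x)) ≢ x
  rotation²-valid k lt x v = rot-V₂ k _ (β²-V _ (rot-V₂ (m ∸ k) x v)) , ne x v
    where
    ne : ∀ x → V₂ n x → σ^ n k (β² (σ^ n (m ∸ k) x)) ≢ x
    ne (num x) v with σ^ n k (β² (σ^ n (m ∸ k) (num x))) | rotRes2 k x lt (v→ v)
    ... | .niInf | sE0 _ = λ ()
    ... | .piInf | sE1 _ = λ ()
    ... | .nInf | sH _ = λ ()
    ... | .pInf | sM _ = λ ()
    ... | ._ | sB a ba _ _ ak = num≢ ba ak (v→ v)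
    ne nInf v rewrite σ^-nI (m ∸ k) | σ^-num k h h<m = λ ()
    ne pInf v rewrite σ^-pI (m ∸ k) | σ^-num k M1 M1<m = λ ()
    ne niInf v rewrite σ^-niI (m ∸ k) | σ^-num k e0 e0<m = λ ()
    ne piInf v rewrite σ^-piI (m ∸ k) | σ^-num k e1 e1<m = λ ()

  last²-valid : ∀ x → V₂ n x → V₂ n (πL x) × πL x ≢ x
  last²-valid (num x) v = v← (<m (x + suc N)) , λ e → step≢ (v→ v) (s≤s z≤n) sN<m (num-inj e)
  last²-valid nInf v = tt , λ ()
  last²-valid pInf v = tt , λ ()
  last²-valid niInf v = tt , λ ()
  last²-valid piInf v = tt , λ ()

  T1-valid : ∀ x → V₂ n x → V₂ n (πT1 x) × πT1 x ≢ x
  T1-valid (num x) v with ev (offset x)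
  ... | true = v← (<m (x + 1)) , λ q → step≢ (v→ v) (s≤s z≤n) 1<m (num-inj q)
  ... | false = v← (<m (x + M1)) , λ q → step≢ (v→ v) (s≤s z≤n) M1<m (num-inj q)
  T1-valid nInf v = tt , λ ()
  T1-valid pInf v = tt , λ ()
  T1-valid niInf v = tt , λ ()
  T1-valid piInf v = tt , λ ()

  T2-valid : ∀ x → V₂ n x → V₂ n (πT2 x) × πT2 x ≢ x
  T2-valid (num x) v with ev (offset x)
  ... | true = v← (<m (x + M1)) , λ q → step≢ (v→ v) (s≤s z≤n) M1<m (num-inj q)
  ... | false = v← (<m (x + 1)) , λ q → step≢ (v→ v) (s≤s z≤n) 1<m (num-inj q)
  T2-valid nInf v = tt , λ ()
  T2-valid pInf v = tt , λ ()
  T2-valid niInf v = tt , λ ()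
  T2-valid piInf v = tt , λ ()

  π²-valid : ∀ r → 1 ≤ r → r ≤ 2 * n + 1 → ∀ x → V₂ n x → V₂ n (π² r x) × π² r x ≢ x
  π²-valid r p q x v with roundCase² p q
  ... | rot2 k lt refl rewrite π²-rot k x lt = rotation²-valid k lt x v
  ... | lst2 refl rewrite π²-L x = last²-valid x v
  ... | tt1 refl rewrite π²-T1 x = T1-valid x v
  ... | tt2 refl rewrite π²-T2 x = T2-valid x v

  a+1<m : ∀ {a} → a ≤ N + N → a + 1 < m
  a+1<m {a} le = s≤s (subst (_≤ suc (N + N)) (+-comm 1 a) (s≤s le))

  e0+1 : mirror e0 ≡ e0 + 1
  e0+1 = trans (proj₂ e0-base) (+-comm 1 e0)

  gap1⇒e0 : ∀ {a k x} → Base a → a + k ≋ x → x < m → gap x ((mirror a + k) % m) ≡ 1 → a ≡ e0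
  gap1⇒e0 {a} {k} {x} ba ak x<m d = mirror-shift-injective {a} {e0} {1} ba e0-isBase (sym eq) e0+1
    where
    y = (mirror a + k) % m
    xy : x + 1 ≋ y
    xy = subst (λ z → x + z ≋ y) d (gap-spec y x<m)
    lem : ∀ a k → a + k + 1 ≡ a + 1 + k
    lem = solve-∀
    eq : a + 1 ≡ mirror a
    eq = uniq (a+1<m (proj₁ ba)) (base< (proj₁ (proj₁ (mirror-involution ba))))
           (cancelʳ k (≋-trans (≡⇒≋ (sym (lem a k))) (≋-trans (≋+ʳ 1 ak) (≋-trans xy (%≋ (mirror a + k))))))

  gapM1⇒e1 : ∀ {a k x} → Base a → a + k ≋ x → x < m → gap x ((mirror a + k) % m) ≡ M1 → a ≡ e1
  gapM1⇒e1 {a} {k} {x} ba ak x<m d = trans (sym inv) (trans (cong mirror beq) (proj₂ e0-base))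
    where
    b = mirror a
    bb = proj₁ (mirror-involution ba)
    inv : mirror b ≡ a
    inv = proj₁ (proj₂ (mirror-involution ba))
    y = (b + k) % m
    xy : x + M1 ≋ y
    xy = subst (λ z → x + z ≋ y) d (gap-spec y x<m)
    lem : ∀ a k N → a + k + suc (N + N) ≡ a + suc (N + N) + k
    lem = solve-∀
    e1' : a + M1 ≋ b
    e1' = cancelʳ k (≋-trans (≡⇒≋ (sym (lem a k N))) (≋-trans (≋+ʳ M1 ak) (≋-trans xy (%≋ (b + k)))))
    lem2 : ∀ a N → a + suc (N + N) + 1 ≡ a + suc (suc (N + N))
    lem2 = solve-∀
    eq : b + 1 ≡ a
    eq = uniq (a+1<m (proj₁ bb)) (base< (proj₁ ba))
           (≋-trans (≋-sym (≋+ʳ 1 e1')) (≋-trans (≡⇒≋ (lem2 a N)) (+m≋ a)))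
    beq : b ≡ e0
    beq = mirror-shift-injective {b} {e0} {1} bb e0-isBase (trans inv (sym eq)) e0+1

  N≢0 : N ≢ 0
  N≢0 e = <⇒≢ N≥1 (sym e)
  sN≢1 : suc N ≢ 1
  sN≢1 e = N≢0 (suc-injective e)
  sN≢M1 : suc N ≢ M1
  sN≢M1 e = N≢0 (sym (+-cancelˡ-≡ N 0 N (trans (+-identityʳ N) (suc-injective e))))
  M1≢1 : M1 ≢ 1
  M1≢1 e = N≢0 (m+n≡0⇒m≡0 N (suc-injective e))

  dec1 : ∀ x → (x + M1) % m + 1 ≋ x
  dec1 x = ≋-trans (≋+ʳ 1 (%≋ (x + M1))) (≋-trans (≡⇒≋ (trans (+-assoc x M1 1) (cong (x +_) (+-comm M1 1)))) (+m≋ x))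

  not-f : ∀ {b} → not b ≡ false → b ≡ true
  not-f {true} _ = refl
  not-t : ∀ {b} → not b ≡ true → b ≡ false
  not-t {false} _ = refl

  round²-of-rotation : ∀ k → k < m → ∀ x → V₂ n x → ρ² x (σ^ n k (β² (σ^ n (m ∸ k) x))) ≡ suc k
  round²-of-rotation k lt (num x) v with σ^ n k (β² (σ^ n (m ∸ k) (num x))) | rotRes2 k x lt (v→ v)
  ... | .niInf | sE0 e = cong suc (gap-unique e0<m lt e)
  ... | .piInf | sE1 e = cong suc (gap-unique e1<m lt e)
  ... | .nInf | sH e = cong suc (gap-unique h<m lt e)
  ... | .pInf | sM e = cong suc (gap-unique M1<m lt e)
  ... | ._ | sB a ba n0 n1 ak = trans (ρ²-oth {x} {(mirror a + k) % m} (λ d → n0 (gap1⇒e0 ba ak (v→ v) d)) (λ d → n1 (gapM1⇒e1 ba ak (v→ v) d)))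
                                      (round-of-base-edge ba lt (v→ v) ak)
  round²-of-rotation k lt nInf v rewrite σ^-nI (m ∸ k) | σ^-num k h h<m = cong suc (gap-unique h<m lt (≋-sym (%≋ (h + k))))
  round²-of-rotation k lt pInf v rewrite σ^-pI (m ∸ k) | σ^-num k M1 M1<m = cong suc (gap-unique M1<m lt (≋-sym (%≋ (M1 + k))))
  round²-of-rotation k lt niInf v rewrite σ^-niI (m ∸ k) | σ^-num k e0 e0<m = cong suc (gap-unique e0<m lt (≋-sym (%≋ (e0 + k))))
  round²-of-rotation k lt piInf v rewrite σ^-piI (m ∸ k) | σ^-num k e1 e1<m = cong suc (gap-unique e1<m lt (≋-sym (%≋ (e1 + k))))

  round²-of-last : ∀ x → V₂ n x → ρ² x (πL x) ≡ Lr
  round²-of-last (num x) v = trans (ρ²-oth {x} {y} (λ d → sN≢1 (trans (sym dL) d)) (λ d → sN≢M1 (trans (sym dL) d))) (ρnum-L {x} {y} dL)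
    where y = (x + suc N) % m
          dL : gap x y ≡ suc N
          dL = gap-unique (v→ v) sN<m (≋-sym (%≋ (x + suc N)))
  round²-of-last nInf v = refl
  round²-of-last pInf v = refl
  round²-of-last niInf v = refl
  round²-of-last piInf v = refl

  offset-pred : ∀ {x} → x < m → ev (offset x) ≡ not (ev (offset ((x + M1) % m)))
  offset-pred {x} x<m = offset-step x<m (<m (x + M1)) (dec1 x)

  gap-pred : ∀ {x} → x < m → gap x ((x + M1) % m) ≡ M1
  gap-pred {x} x<m = gap-unique x<m M1<m (≋-sym (%≋ (x + M1)))

  gap-succ : ∀ {x} → x < m → gap x ((x + 1) % m) ≡ 1
  gap-succ {x} x<m = gap-unique x<m 1<m (≋-sym (%≋ (x + 1)))

  round²-of-T1 : ∀ x → V₂ n x → ρ² x (πT1 x) ≡ suc Lr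
  round²-of-T1 (num x) v with ev (offset x) in e
  ... | true = trans (ρ²-1 {x} {(x + 1) % m} (gap-succ (v→ v))) (tRound-even {x} e)
  ... | false = trans (ρ²-M1 {x} {(x + M1) % m} (λ d → M1≢1 (trans (sym (gap-pred (v→ v))) d)) (gap-pred (v→ v)))
                      (tRound-even {(x + M1) % m} (not-f (trans (sym (offset-pred (v→ v))) e)))
  round²-of-T1 nInf v = refl
  round²-of-T1 pInf v = refl
  round²-of-T1 niInf v = refl
  round²-of-T1 piInf v = refl

  round²-of-T2 : ∀ x → V₂ n x → ρ² x (πT2 x) ≡ suc (suc Lr)
  round²-of-T2 (num x) v with ev (offset x) in e
  ... | false = trans (ρ²-1 {x} {(x + 1) % m} (gap-succ (v→ v))) (tRound-odd {x} e)
  ... | true = trans (ρ²-M1 {x} {(x + M1) % m} (λ d → M1≢1 (trans (sym (gap-pred (v→ v))) d)) (gap-pred (v→ v)))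
                     (tRound-odd {(x + M1) % m} (not-t (trans (sym (offset-pred (v→ v))) e)))
  round²-of-T2 nInf v = refl
  round²-of-T2 pInf v = refl
  round²-of-T2 niInf v = refl
  round²-of-T2 piInf v = refl

  ρ²-of-π² : ∀ r → 1 ≤ r → r ≤ 2 * n + 1 → ∀ x → V₂ n x → ρ² x (π² r x) ≡ r
  ρ²-of-π² r p q x v with roundCase² p q
  ... | rot2 k lt refl rewrite π²-rot k x lt = round²-of-rotation k lt x v
  ... | lst2 refl rewrite π²-L x = round²-of-last x v
  ... | tt1 refl rewrite π²-T1 x = round²-of-T1 x v
  ... | tt2 refl rewrite π²-T2 x = round²-of-T2 x v

  InRound² : Pt → Pt → ℕ → Set
  InRound² x y r = 1 ≤ r × r ≤ 2 * n + 1 × π² r x ≡ y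

  inRound² : ∀ {x y r} → 1 ≤ r → r ≤ suc (suc Lr) → π² r x ≡ y → InRound² x y r
  inRound² {r = r} p q e = p , subst (r ≤_) (sym L2≡) q , e

  rotation-round≤ : ∀ {k} → k < m → suc k ≤ suc (suc Lr)
  rotation-round≤ lt = m≤n⇒m≤1+n (m≤n⇒m≤1+n (m≤n⇒m≤1+n lt))

  last-round≤ : Lr ≤ suc (suc Lr)
  last-round≤ = m≤n⇒m≤1+n (m≤n⇒m≤1+n ≤-refl)
  T1-round≤ : suc Lr ≤ suc (suc Lr)
  T1-round≤ = m≤n⇒m≤1+n ≤-refl

  data GapClass (x y : ℕ) : Set where
    gap1 : gap x y ≡ 1 → GapClass x y
    gapM1 : gap x y ≢ 1 → gap x y ≡ M1 → GapClass x y
    gapOther : gap x y ≢ 1 → gap x y ≢ M1 → GapClass x y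

  gapClass : ∀ x y → GapClass x y
  gapClass x y with gap x y ≟ 1
  ... | yes e = gap1 e
  ... | no n1 with gap x y ≟ M1
  ...   | yes e = gapM1 n1 e
  ...   | no nM = gapOther n1 nM

  h≢e0 : h ≢ e0
  h≢e0 e = proj₂ e0-isBase (sym e)
  h≢e1 : h ≢ e1
  h≢e1 e = proj₂ e1-isBase (sym e)
  M1≢e0 : M1 ≢ e0
  M1≢e0 e = base≢M1 (proj₁ e0-isBase) (sym e)
  M1≢e1 : M1 ≢ e1
  M1≢e1 e = base≢M1 (proj₁ e1-isBase) (sym e)

  rot² : ∀ {k x y} → k < m → rotPartner β² k x ≡ y → InRound² x y (suc k)
  rot² {k} {x} k<m e = inRound² (s≤s z≤n) (rotation-round≤ k<m) (trans (π²-rot k x k<m) e)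

  gap1-round : ∀ {x y} → x < m → y < m → gap x y ≡ 1 → InRound² (num x) (num y) (tRound x)
  gap1-round {x} {y} x<m y<m d = by-parity (ev (offset x)) refl
    where
    x1 : (x + 1) % m ≡ y
    x1 = mod≡ y<m (subst (λ z → x + z ≋ y) d (gap-spec y x<m))
    by-parity : ∀ b → ev (offset x) ≡ b → InRound² (num x) (num y) (tRound x)
    by-parity true e = subst (InRound² (num x) (num y)) (sym (tRound-even {x} e)) (inRound² (s≤s z≤n) T1-round≤ (trans (π²-T1 (num x)) (trans (πT1-ev {x} e) (cong num x1))))
    by-parity false e = subst (InRound² (num x) (num y)) (sym (tRound-odd {x} e)) (inRound² (s≤s z≤n) ≤-refl (trans (π²-T2 (num x)) (trans (πT2-od {x} e) (cong num x1))))

  gapM1-round : ∀ {x y} → x < m → y < m → gap x y ≡ M1 → InRound² (num x) (num y) (tRound y)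
  gapM1-round {x} {y} x<m y<m d = by-parity (ev (offset y)) refl
    where
    x1 : (x + M1) % m ≡ y
    x1 = mod≡ y<m (subst (λ z → x + z ≋ y) d (gap-spec y x<m))
    st : ev (offset x) ≡ not (ev (offset y))
    st = offset-step x<m y<m (subst (λ z → z + 1 ≋ x) x1 (dec1 x))
    by-parity : ∀ b → ev (offset y) ≡ b → InRound² (num x) (num y) (tRound y)
    by-parity true e = subst (InRound² (num x) (num y)) (sym (tRound-even {y} e)) (inRound² (s≤s z≤n) T1-round≤ (trans (π²-T1 (num x)) (trans (πT1-od {x} (trans st (cong not e))) (cong num x1))))
    by-parity false e = subst (InRound² (num x) (num y)) (sym (tRound-odd {y} e)) (inRound² (s≤s z≤n) ≤-refl (trans (π²-T2 (num x)) (trans (πT2-ev {x} (trans st (cong not e))) (cong num x1))))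

  -- pairs of any other gap lie in the same round as in F¹; the base edge they
  -- come from avoids e* since its gap is not ±1
  other-gap-round : ∀ {x y} → x < m → y < m → x ≢ y → gap x y ≢ 1 → gap x y ≢ M1 → InRound² (num x) (num y) (ρnum x y)
  other-gap-round {x} {y} x<m y<m ne n1 nM with diameter? x y
  ... | inj₁ e = subst (InRound² (num x) (num y)) (sym (ρnum-L {x} {y} e)) (inRound² (s≤s z≤n) last-round≤
                   (trans (π²-L (num x)) (cong num (mod≡ y<m (subst (λ z → x + z ≋ y) e (gap-spec y x<m))))))
  ... | inj₂ ne' with base-edge-of-round x<m y<m ne ne'
  ...   | a , k , ba , k<m , ρeq , ax , by = subst (InRound² (num x) (num y)) (sym ρeq)
            (rot² k<m (rotated-base β² (trans (β²-oth n0 n1') (β¹-base ba)) ba k<m x<m y<m ax by))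
    where
    n0 : a ≢ e0
    n0 refl = n1 (gap-unique x<m 1<m (≋-trans (≡⇒≋ (+-comm x 1)) (≋-trans (≋+ˡ 1 (≋-sym ax))
               (≋-trans (≡⇒≋ (cong (_+ k) (sym (proj₂ e0-base)))) by))))
    n1' : a ≢ e1
    n1' refl = nM (gap-unique x<m M1<m (≋-trans (≋+ʳ M1 (≋-sym ax)) (≋-trans (≡⇒≋ (lem e0 k N))
                 (≋-trans (+m≋ (e0 + k)) (≋-trans (≡⇒≋ (cong (_+ k) (sym mirror-e1))) by)))))
      where lem : ∀ e k N → suc e + k + suc (N + N) ≡ e + k + suc (suc (N + N))
            lem = solve-∀

  π²-of-ρ² : ∀ x y → V₂ n x → V₂ n y → x ≢ y → 1 ≤ ρ² x y × ρ² x y ≤ 2 * n + 1 × π² (ρ² x y) x ≡ y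
  π²-of-ρ² (num x) (num y) vx vy ne with gapClass x y
  ... | gap1 d = subst (InRound² (num x) (num y)) (sym (ρ²-1 {x} {y} d)) (gap1-round (v→ vx) (v→ vy) d)
  ... | gapM1 n1 d = subst (InRound² (num x) (num y)) (sym (ρ²-M1 {x} {y} n1 d)) (gapM1-round (v→ vx) (v→ vy) d)
  ... | gapOther n1 nM = subst (InRound² (num x) (num y)) (sym (ρ²-oth {x} {y} n1 nM)) (other-gap-round (v→ vx) (v→ vy) (λ e → ne (cong num e)) n1 nM)
  π²-of-ρ² (num x) nInf vx vy ne = rot² (<m (x + (m ∸ h))) (toward-∞ β² h<m (trans (β²-oth h≢e0 h≢e1) β¹-h) σ^-nI (v→ vx))
  π²-of-ρ² (num x) pInf vx vy ne = rot² (<m (x + (m ∸ M1))) (toward-∞ β² M1<m (trans (β²-oth M1≢e0 M1≢e1) β¹-M1) σ^-pI (v→ vx))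
  π²-of-ρ² (num x) niInf vx vy ne = rot² (<m (x + (m ∸ e0))) (toward-∞ β² e0<m β²-e0 σ^-niI (v→ vx))
  π²-of-ρ² (num x) piInf vx vy ne = rot² (<m (x + (m ∸ e1))) (toward-∞ β² e1<m β²-e1 σ^-piI (v→ vx))
  π²-of-ρ² nInf (num y) vx vy ne = rot² (<m (y + (m ∸ h))) (from-∞ β² h<m refl σ^-nI (v→ vy))
  π²-of-ρ² pInf (num y) vx vy ne = rot² (<m (y + (m ∸ M1))) (from-∞ β² M1<m refl σ^-pI (v→ vy))
  π²-of-ρ² niInf (num y) vx vy ne = rot² (<m (y + (m ∸ e0))) (from-∞ β² e0<m refl σ^-niI (v→ vy))
  π²-of-ρ² piInf (num y) vx vy ne = rot² (<m (y + (m ∸ e1))) (from-∞ β² e1<m refl σ^-piI (v→ vy))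
  π²-of-ρ² nInf niInf vx vy ne = inRound² (s≤s z≤n) T1-round≤ (π²-T1 nInf)
  π²-of-ρ² niInf nInf vx vy ne = inRound² (s≤s z≤n) T1-round≤ (π²-T1 niInf)
  π²-of-ρ² pInf piInf vx vy ne = inRound² (s≤s z≤n) T1-round≤ (π²-T1 pInf)
  π²-of-ρ² piInf pInf vx vy ne = inRound² (s≤s z≤n) T1-round≤ (π²-T1 piInf)
  π²-of-ρ² nInf piInf vx vy ne = inRound² (s≤s z≤n) ≤-refl (π²-T2 nInf)
  π²-of-ρ² piInf nInf vx vy ne = inRound² (s≤s z≤n) ≤-refl (π²-T2 piInf)
  π²-of-ρ² pInf niInf vx vy ne = inRound² (s≤s z≤n) ≤-refl (π²-T2 pInf)
  π²-of-ρ² niInf pInf vx vy ne = inRound² (s≤s z≤n) ≤-refl (π²-T2 niInf)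
  π²-of-ρ² niInf piInf vx vy ne = inRound² (s≤s z≤n) last-round≤ (π²-L niInf)
  π²-of-ρ² piInf niInf vx vy ne = inRound² (s≤s z≤n) last-round≤ (π²-L piInf)
  π²-of-ρ² nInf pInf vx vy ne = inRound² (s≤s z≤n) last-round≤ (π²-L nInf)
  π²-of-ρ² pInf nInf vx vy ne = inRound² (s≤s z≤n) last-round≤ (π²-L pInf)
  π²-of-ρ² nInf nInf vx vy ne = ⊥-elim (ne refl)
  π²-of-ρ² pInf pInf vx vy ne = ⊥-elim (ne refl)
  π²-of-ρ² niInf niInf vx vy ne = ⊥-elim (ne refl)
  π²-of-ρ² piInf piInf vx vy ne = ⊥-elim (ne refl)

  module G2 = OneFactorisationCriterion (V₂ n) (2 * n + 1) (F² n) π² ρ² F²⇒π² π²∈F² π²-valid ρ²-of-π² π²-of-ρ²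

  -- Rounds r ≤ 2n-1 of the two families agree on every edge
  -- avoiding ±i∞, except that F² moves the edges of gap ±1 to rounds 2n, 2n+1;
  -- of those only e* (rounds 1, 2n) and σ(e*) (rounds 2, 2n+1) stay common.
  -- commonList enumerates the common edges: numeric {a,b} with a + 1 < b and
  -- {a,b} ≠ {0, M1}, all edges to -∞ and to ∞, and {-∞,∞}, e*, σ(e*).

  lastBlock : List Edge
  lastBlock = map (λ x → (num (suc x) , num M1)) (upTo (M1 ∸ 2))

  Lnum LnI LpI Lrest commonList : List Edge
  Lnum = pairsUpTo M1 ++ lastBlock
  LnI = map (λ x → (num x , nInf)) (upTo m)
  LpI = map (λ x → (num x , pInf)) (upTo m)
  Lrest = (nInf , pInf) ∷ (num e0 , num e1) ∷ (num e1 , num (suc e1)) ∷ []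
  commonList = Lnum ++ (LnI ++ (LpI ++ Lrest))

  listed-length : length commonList ≡ 2 * n * n ∸ 3 * n + 4
  listed-length = trans (length-++ Lnum) (trans (cong₂ _+_ (trans (length-++ (pairsUpTo M1)) (cong₂ _+_ (length-pairs M1) (trans (length-map _ (upTo (M1 ∸ 2))) (length-upTo (M1 ∸ 2)))))
     (trans (length-++ LnI) (cong₂ _+_ (trans (length-map _ (upTo m)) (length-upTo m)) (trans (length-++ LpI) (cong (_+ 3) (trans (length-map _ (upTo m)) (length-upTo m)))))))
     (count-arith N N≥1))

  Spread : Edge → Set
  Spread e = Σ ℕ λ a → Σ ℕ λ b → e ≡ (num a , num b) × suc a < b × b < m × ¬ (a ≡ 0 × b ≡ M1)

  Lnum-spread : ∀ {e} → e ∈ Lnum → Spread e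
  Lnum-spread p with ∈-++⁻ (pairsUpTo M1) p
  ... | inj₁ q with pairs∈ M1 q
  ...   | a , b , refl , l1 , l2 = a , b , refl , l1 , m≤n⇒m≤1+n l2 , λ { (_ , e) → <-irrefl e l2 }
  Lnum-spread p | inj₂ q with mem-map q
  ...   | i , lt , refl = suc i , M1 , refl , s≤s (<∸1 lt) , M1<m , λ { (() , _) }

  spread≢gap1 : ∀ {e a} → Spread e → Distinct e (num a , num (suc a))
  spread≢gap1 (a , b , refl , l1 , _) s = <-irrefl (trans (cong suc p) (sym q)) l1
    where pq = ordered-Same (<-trans (n<1+n a) l1) (n<1+n _) s
          p = proj₁ pq
          q = proj₂ pq

  kind-num : ∀ {e} → e ∈ Lnum → kind e ≡ 2
  kind-num p with Lnum-spread p
  ... | _ , _ , refl , _ = refl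

  kind-nI : ∀ {e} → e ∈ LnI → kind e ≡ 3
  kind-nI p with mem-map p
  ... | _ , _ , refl = refl

  kind-pI : ∀ {e} → e ∈ LpI → kind e ≡ 5
  kind-pI p with mem-map p
  ... | _ , _ , refl = refl

  apart : ∀ {e f k l} → kind e ≡ k → kind f ≡ l → k ≢ l → Distinct e f
  apart refl refl = byKind

  star-distinct : ∀ p k → AllPairs Distinct (map (λ x → (num x , p)) (upTo k))
  star-distinct p k = APmap (λ x → (num x , p)) k
      (λ { i<j (inj₁ (e , _)) → <-irrefl (num-inj e) i<j ; i<j (inj₂ (e , e')) → <-irrefl (num-inj (trans e e')) i<j })

  Lnum-distinct : AllPairs Distinct Lnum
  Lnum-distinct = AP++ (pairs-distinct M1) last-distinct pair≢last
    where
    last-distinct : AllPairs Distinct lastBlock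
    last-distinct = APmap (λ x → (num (suc x) , num M1)) (M1 ∸ 2)
        (λ { i<j (inj₁ (e , _)) → <-irrefl (suc-injective (num-inj e)) i<j
           ; i<j (inj₂ (e , e')) → <-irrefl (suc-injective (num-inj (trans e e'))) i<j })
    pair≢last : ∀ {e f} → e ∈ pairsUpTo M1 → f ∈ lastBlock → Distinct e f
    pair≢last e∈ f∈ with pairs∈ M1 e∈ | mem-map f∈
    ... | a , b , refl , l1 , l2 | i , lt , refl = λ s → <-irrefl (proj₂ (ordered-Same (<-trans (n<1+n a) l1) (s≤s (<⇒≤ (<∸1 lt))) s)) l2

  Lrest-distinct : AllPairs Distinct Lrest
  Lrest-distinct = (byKind (λ ()) ∷ byKind (λ ()) ∷ []) ∷ (e*≢σe* ∷ []) ∷ [] ∷ []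
    where
    e*≢σe* : Distinct (num e0 , num e1) (num e1 , num (suc e1))
    e*≢σe* (inj₁ (e , _)) = e1≢e0 (sym (num-inj e))
    e*≢σe* (inj₂ (e , _)) = <-irrefl (num-inj e) (s≤s (n≤1+n e0))

  num≢other : ∀ {e f} → e ∈ Lnum → f ∈ LnI ++ (LpI ++ Lrest) → Distinct e f
  num≢other e∈ f∈ with ∈-++⁻ LnI f∈
  ... | inj₁ q = apart (kind-num e∈) (kind-nI q) (λ ())
  ... | inj₂ q with ∈-++⁻ LpI q
  ...   | inj₁ q' = apart (kind-num e∈) (kind-pI q') (λ ())
  ...   | inj₂ (here refl) = apart (kind-num e∈) refl (λ ())
  ...   | inj₂ (there (here refl)) = spread≢gap1 (Lnum-spread e∈)
  ...   | inj₂ (there (there (here refl))) = spread≢gap1 (Lnum-spread e∈)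

  nI≢other : ∀ {e f} → e ∈ LnI → f ∈ LpI ++ Lrest → Distinct e f
  nI≢other e∈ f∈ with ∈-++⁻ LpI f∈
  ... | inj₁ q = apart (kind-nI e∈) (kind-pI q) (λ ())
  ... | inj₂ (here refl) = apart (kind-nI e∈) refl (λ ())
  ... | inj₂ (there (here refl)) = apart (kind-nI e∈) refl (λ ())
  ... | inj₂ (there (there (here refl))) = apart (kind-nI e∈) refl (λ ())

  pI≢rest : ∀ {e f} → e ∈ LpI → f ∈ Lrest → Distinct e f
  pI≢rest e∈ (here refl) = apart (kind-pI e∈) refl (λ ())
  pI≢rest e∈ (there (here refl)) = apart (kind-pI e∈) refl (λ ())
  pI≢rest e∈ (there (there (here refl))) = apart (kind-pI e∈) refl (λ ())

  listed-distinct : AllPairs Distinct commonList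
  listed-distinct = AP++ Lnum-distinct (AP++ (star-distinct nInf m) (AP++ (star-distinct pInf m) Lrest-distinct pI≢rest) nI≢other) num≢other

  Common-by-rounds : ∀ x y r r' → V₁ n x → V₁ n y → x ≢ y → ρ¹ x y ≡ r → ρ² x y ≡ r' → CongMod (2 * n ∸ 1) r' r → Common n x y
  Common-by-rounds x y r r' vx vy ne refl refl cm = ρ¹ x y , ρ² x y ,
      proj₁ rg1 , proj₂ rg1 , proj₁ rg2 , proj₂ rg2 , cm ,
      G1.edge∈round x y vx vy ne , G2.edge∈round x y (V₁⇒V₂ x vx) (V₁⇒V₂ y vy) ne
    where
    rg1 = G1.round-range x y vx vy ne
    rg2 = G2.round-range x y (V₁⇒V₂ x vx) (V₁⇒V₂ y vy) ne

  Common-same-round : ∀ x y → V₁ n x → V₁ n y → x ≢ y → ρ² x y ≡ ρ¹ x y → Common n x y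
  Common-same-round x y vx vy ne eq = Common-by-rounds x y (ρ¹ x y) (ρ¹ x y) vx vy ne refl eq (0 , inj₁ (sym (+-identityʳ _)))

  gap-ordered : ∀ {a b} → a < b → b < m → gap a b ≡ b ∸ a
  gap-ordered {a} {b} lt b<m = gap-unique (<-trans lt b<m) (≤-<-trans (m∸n≤m b a) b<m) (≡⇒≋ (m+[n∸m]≡n (<⇒≤ lt)))

  CommonEdge : Edge → Set
  CommonEdge (x , y) = V₁ n x × V₁ n y × x ≢ y × Common n x y

  se1<m : suc e1 < m
  se1<m = e0-bound

  -- e* lies in rounds 1 and 2n = 1 + (2n-1)
  e*-common : CommonEdge (num e0 , num e1)
  e*-common = v← e0<m , v← e1<m , e0≢e1 , Common-by-rounds (num e0) (num e1) 1 (suc Lr) (v← e0<m) (v← e1<m) e0≢e1 r1 r2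
            (1 , inj₁ (trans (cong suc (sym (+-identityʳ Lr))) (sym (cong (λ z → 1 + 1 * z) L≡))))
    where
    e0≢e1 : num e0 ≢ num e1
    e0≢e1 e = e1≢e0 (sym (num-inj e))
    y≡ : (mirror e0 + 0) % m ≡ e1
    y≡ = mod≡ e1<m (≡⇒≋ (trans (+-identityʳ (mirror e0)) (proj₂ e0-base)))
    r1 : ρnum e0 e1 ≡ 1
    r1 = subst (λ z → ρnum e0 z ≡ 1) y≡ (round-of-base-edge e0-isBase (s≤s z≤n) e0<m (≡⇒≋ (+-identityʳ e0)))
    r2 : ρ²num e0 e1 ≡ suc Lr
    r2 = trans (ρ²-1 {e0} {e1} (gap-unique e0<m 1<m (≡⇒≋ (+-comm e0 1)))) (tRound-even {e0} (cong ev (gap-unique e0<m (s≤s z≤n) (≡⇒≋ (+-identityʳ e0)))))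

  -- σ(e*) lies in rounds 2 and 2n+1 = 2 + (2n-1)
  σe*-common : CommonEdge (num e1 , num (suc e1))
  σe*-common = v← e1<m , v← se1<m , ne , Common-by-rounds (num e1) (num (suc e1)) 2 (suc (suc Lr)) (v← e1<m) (v← se1<m) ne r1 r2
            (1 , inj₁ (trans (cong (λ z → suc (suc z)) (sym (+-identityʳ Lr))) (sym (cong (λ z → 2 + 1 * z) L≡))))
    where
    ne : num e1 ≢ num (suc e1)
    ne e = <-irrefl (num-inj e) ≤-refl
    y≡ : (mirror e0 + 1) % m ≡ suc e1
    y≡ = mod≡ se1<m (≡⇒≋ (trans (cong (_+ 1) (proj₂ e0-base)) (+-comm e1 1)))
    r1 : ρnum e1 (suc e1) ≡ 2
    r1 = subst (λ z → ρnum e1 z ≡ 2) y≡ (round-of-base-edge e0-isBase 1<m e1<m (≡⇒≋ (+-comm e0 1)))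
    r2 : ρ²num e1 (suc e1) ≡ suc (suc Lr)
    r2 = trans (ρ²-1 {e1} {suc e1} (gap-unique e1<m 1<m (≡⇒≋ (+-comm e1 1)))) (tRound-odd {e1} (cong ev (gap-unique e0<m 1<m (≡⇒≋ (+-comm e0 1)))))

  -- a spread numeric edge has gap neither 1 nor M1, so it lies in the same round of both families
  spread-common : ∀ {e} → Spread e → CommonEdge e
  spread-common (a , b , refl , l1 , b<m , nz) = v← a<m , v← b<m , a≢b ,
      Common-same-round (num a) (num b) (v← a<m) (v← b<m) a≢b (ρ²-oth {a} {b} n1 nM)
    where
    a<b : a < b
    a<b = <-trans (n<1+n a) l1
    a<m = <-trans a<b b<m
    a≢b : num a ≢ num b
    a≢b e = <-irrefl (num-inj e) a<b
    b≡ : ∀ {d} → b ∸ a ≡ d → b ≡ a + d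
    b≡ e = trans (sym (m+[n∸m]≡n (<⇒≤ a<b))) (cong (a +_) e)
    n1 : gap a b ≢ 1
    n1 e = <-irrefl (sym (trans (b≡ (trans (sym (gap-ordered a<b b<m)) e)) (+-comm a 1))) l1
    nM : gap a b ≢ M1
    nM e = nz (a0 , trans (b≡ e') (cong (_+ M1) a0))
      where
      e' : b ∸ a ≡ M1
      e' = trans (sym (gap-ordered a<b b<m)) e
      a0 : a ≡ 0
      a0 = n≤0⇒n≡0 (+-cancelʳ-≤ M1 a 0 (subst (_≤ M1) (b≡ e') (≤-pred b<m)))

  listed-common : All CommonEdge commonList
  listed-common = allTab common
    where
    common : ∀ {e} → e ∈ commonList → CommonEdge e
    common p with ∈-++⁻ Lnum p
    ... | inj₁ q = spread-common (Lnum-spread q)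
    ... | inj₂ q with ∈-++⁻ LnI q
    ...   | inj₁ r with mem-map r
    ...     | i , lt , refl = v← lt , tt , (λ ()) , Common-same-round (num i) nInf (v← lt) tt (λ ()) refl
    common p | inj₂ q | inj₂ r with ∈-++⁻ LpI r
    ... | inj₁ r' with mem-map r'
    ...   | i , lt , refl = v← lt , tt , (λ ()) , Common-same-round (num i) pInf (v← lt) tt (λ ()) refl
    common p | inj₂ q | inj₂ r | inj₂ (here refl) = tt , tt , (λ ()) , Common-same-round nInf pInf tt tt (λ ()) refl
    common p | inj₂ q | inj₂ r | inj₂ (there (here refl)) = e*-common
    common p | inj₂ q | inj₂ r | inj₂ (there (there (here refl))) = σe*-common

  -- Conversely, a common edge of gap ±1 must be e* or σ(e*): its F¹-round is
  -- 1 + offset of its lower end, which wrap-around forces to be 1 or 2.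

  ExtraRound : ℕ → Set
  ExtraRound r = r ≡ suc Lr ⊎ r ≡ suc (suc Lr)

  tRound-values : ∀ z → ExtraRound (tRound z)
  tRound-values z with ev (offset z)
  ... | true = inj₁ refl
  ... | false = inj₂ refl

  extra-wraps : ∀ {r r'} → 1 ≤ r → r ≤ 2 * n ∸ 1 → CongMod (2 * n ∸ 1) r' r → ExtraRound r' → r ≡ 1 ⊎ r ≡ 2
  extra-wraps p q cm big = wrap-around (subst (1 <_) (sym L≡) (s≤s (s≤s z≤n))) p q cm
    ([ (λ e → inj₁ (trans e (cong suc (sym L≡)))) , (λ e → inj₂ (trans e (cong (λ z → suc (suc z)) (sym L≡)))) ] big)

  offset≤1 : ∀ {z} → z < m → suc (offset z) ≡ 1 ⊎ suc (offset z) ≡ 2 → z ≡ e0 ⊎ z ≡ e1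
  offset≤1 {z} z<m (inj₁ e) = inj₁ (sym (uniq e0<m z<m (≋-trans (≡⇒≋ (sym (+-identityʳ e0))) (subst (λ c → e0 + c ≋ z) (suc-injective e) (gap-spec z e0<m)))))
  offset≤1 {z} z<m (inj₂ e) = inj₂ (sym (uniq e1<m z<m (≋-trans (≡⇒≋ (+-comm 1 e0)) (subst (λ c → e0 + c ≋ z) (suc-injective e) (gap-spec z e0<m)))))

  gapPoint1 : gapPoint 1 ≡ e0
  gapPoint1 = gapPoint-unique e0-isBase e0+1 (s≤s z≤n) N≥1

  AnyS : Edge → List Edge → Set
  AnyS p xs = Any (λ f → Same f p) xs

  common-gap1 : ∀ {x y} → x < m → y < m → gap x y ≡ 1 → Common n (num x) (num y) → AnyS (num x , num y) Lrest
  common-gap1 {x} {y} x<m y<m d (r , r' , p1 , p2 , p3 , p4 , cm , f1 , f2) = listed (offset≤1 x<m (subst (λ z → z ≡ 1 ⊎ z ≡ 2) ρv rv))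
    where
    rr' : r' ≡ tRound x
    rr' = trans (G2.round-unique r' p3 p4 (num x) (num y) f2) (ρ²-1 {x} {y} d)
    rv : r ≡ 1 ⊎ r ≡ 2
    rv = extra-wraps p1 p2 cm (subst ExtraRound (sym rr') (tRound-values x))
    ρv : r ≡ suc (offset x)
    ρv = begin
      r                              ≡⟨ G1.round-unique r p1 p2 (num x) (num y) f1 ⟩
      ρnum x y                       ≡⟨ ρnum-lo {x} {y} (λ q → sN≢1 (trans (sym q) d)) (subst (_≤ N) (sym d) N≥1) ⟩
      suc (gap (gapPoint (gap x y)) x) ≡⟨ cong (λ z → suc (gap (gapPoint z) x)) d ⟩
      suc (gap (gapPoint 1) x)       ≡⟨ cong (λ z → suc (gap z x)) gapPoint1 ⟩
      suc (offset x)                 ∎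
      where open ≡-Reasoning
    xy : x + 1 ≋ y
    xy = subst (λ z → x + z ≋ y) d (gap-spec y x<m)
    listed : x ≡ e0 ⊎ x ≡ e1 → AnyS (num x , num y) Lrest
    listed (inj₁ refl) = there (here (inj₁ (refl , cong num (uniq e1<m y<m (≋-trans (≡⇒≋ (+-comm 1 e0)) xy)))))
    listed (inj₂ refl) = there (there (here (inj₁ (refl , cong num (uniq se1<m y<m (≋-trans (≡⇒≋ (+-comm 1 e1)) xy))))))

  common-gapM1 : ∀ {x y} → x < m → y < m → gap x y ≢ 1 → gap x y ≡ M1 → Common n (num x) (num y) → AnyS (num x , num y) Lrest
  common-gapM1 {x} {y} x<m y<m n1 d (r , r' , p1 , p2 , p3 , p4 , cm , f1 , f2) = listed (offset≤1 y<m (subst (λ z → z ≡ 1 ⊎ z ≡ 2) ρv rv))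
    where
    rr' : r' ≡ tRound y
    rr' = trans (G2.round-unique r' p3 p4 (num x) (num y) f2) (ρ²-M1 {x} {y} n1 d)
    rv : r ≡ 1 ⊎ r ≡ 2
    rv = extra-wraps p1 p2 cm (subst ExtraRound (sym rr') (tRound-values y))
    ρv : r ≡ suc (offset y)
    ρv = begin
      r                                  ≡⟨ G1.round-unique r p1 p2 (num x) (num y) f1 ⟩
      ρnum x y                           ≡⟨ ρnum-hi {x} {y} (λ q → sN≢M1 (trans (sym q) d)) (λ le → M1≰N (subst (_≤ N) d le)) ⟩
      suc (gap (gapPoint (m ∸ gap x y)) y) ≡⟨ cong (λ z → suc (gap (gapPoint (m ∸ z)) y)) d ⟩
      suc (gap (gapPoint (m ∸ M1)) y)    ≡⟨ cong (λ z → suc (gap (gapPoint z) y)) (m+n∸n≡m 1 M1) ⟩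
      suc (gap (gapPoint 1) y)           ≡⟨ cong (λ z → suc (gap z y)) gapPoint1 ⟩
      suc (offset y)                     ∎
      where open ≡-Reasoning
            M1≰N : ¬ M1 ≤ N
            M1≰N le = <⇒≱ (s≤s (m≤m+n N N)) le
    yx : y + 1 ≋ x
    yx = ≋-trans (≋+ʳ 1 (≋-sym (subst (λ z → x + z ≋ y) d (gap-spec y x<m)))) (≋-trans (≡⇒≋ (trans (+-assoc x M1 1) (cong (x +_) (+-comm M1 1)))) (+m≋ x))
    listed : y ≡ e0 ⊎ y ≡ e1 → AnyS (num x , num y) Lrest
    listed (inj₁ refl) = there (here (inj₂ (refl , cong num (uniq e1<m x<m (≋-trans (≡⇒≋ (+-comm 1 e0)) yx)))))
    listed (inj₂ refl) = there (there (here (inj₂ (refl , cong num (uniq se1<m x<m (≋-trans (≡⇒≋ (+-comm 1 e1)) yx))))))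

  inRest : ∀ {p} → AnyS p Lrest → AnyS p commonList
  inRest a = AnyP.++⁺ʳ Lnum (AnyP.++⁺ʳ LnI (AnyP.++⁺ʳ LpI a))

  inNum : ∀ {a b} → suc a < b → b < m → ¬ (a ≡ 0 × b ≡ M1) → (num a , num b) ∈ commonList
  inNum {a} {b} l1 b<m nz with m≤n⇒m<n∨m≡n (≤-pred b<m)
  ... | inj₁ lt = ∈-++⁺ˡ (∈-++⁺ˡ (pairs∋ M1 l1 lt))
  ... | inj₂ refl = ∈-++⁺ˡ (∈-++⁺ʳ (pairsUpTo M1) (lastmem a l1 nz))
    where
    lastmem : ∀ a → suc a < M1 → ¬ (a ≡ 0 × M1 ≡ M1) → (num a , num M1) ∈ lastBlock
    lastmem zero _ nz = ⊥-elim (nz (refl , refl))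
    lastmem (suc a') l _ = ∈-map⁺ (λ x → (num (suc x) , num M1)) (∈-upTo⁺ (<∸1' (≤-pred l)))

  other-gap-listed : ∀ {x y} → x < m → y < m → x ≢ y → gap x y ≢ 1 → gap x y ≢ M1 → AnyS (num x , num y) commonList
  other-gap-listed {x} {y} x<m y<m ne n1 nM with <-cmp x y
  ... | tri≈ _ e _ = ⊥-elim (ne e)
  ... | tri< lt _ _ = lose (inNum l1 y<m nz) (inj₁ (refl , refl))
    where l1 : suc x < y
          l1 = ≤∧≢⇒< lt (λ e → n1 (gap-unique x<m 1<m (≡⇒≋ (trans (+-comm x 1) e))))
          nz : ¬ (x ≡ 0 × y ≡ M1)
          nz (refl , refl) = nM (gap-unique (s≤s z≤n) M1<m ≋-refl)
  ... | tri> _ _ gt = lose (inNum l1 x<m nz) (inj₂ (refl , refl))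
    where l1 : suc y < x
          l1 = ≤∧≢⇒< gt (λ e → nM (gap-unique x<m M1<m (≋-trans (≡⇒≋ (trans (cong (_+ M1) (sym e)) (sym (+-suc y M1)))) (+m≋ y))))
          nz : ¬ (y ≡ 0 × x ≡ M1)
          nz (refl , refl) = n1 (gap-unique M1<m 1<m (≋-trans (≡⇒≋ (+-comm M1 1)) (+m≋ 0)))

  common-listed : ∀ x y → V₁ n x → V₁ n y → x ≢ y → Common n x y → AnyS (x , y) commonList
  common-listed (num x) (num y) vx vy ne c with gapClass x y
  ... | gap1 d = inRest (common-gap1 (v→ vx) (v→ vy) d c)
  ... | gapM1 n1 d = inRest (common-gapM1 (v→ vx) (v→ vy) n1 d c)
  ... | gapOther n1 nM = other-gap-listed (v→ vx) (v→ vy) (λ e → ne (cong num e)) n1 nM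
  common-listed (num x) nInf vx vy ne c = lose (∈-++⁺ʳ Lnum (∈-++⁺ˡ (∈-map⁺ (λ x → (num x , nInf)) (∈-upTo⁺ (v→ vx))))) (inj₁ (refl , refl))
  common-listed nInf (num x) vx vy ne c = lose (∈-++⁺ʳ Lnum (∈-++⁺ˡ (∈-map⁺ (λ x → (num x , nInf)) (∈-upTo⁺ (v→ vy))))) (inj₂ (refl , refl))
  common-listed (num x) pInf vx vy ne c = lose (∈-++⁺ʳ Lnum (∈-++⁺ʳ LnI (∈-++⁺ˡ (∈-map⁺ (λ x → (num x , pInf)) (∈-upTo⁺ (v→ vx)))))) (inj₁ (refl , refl))
  common-listed pInf (num x) vx vy ne c = lose (∈-++⁺ʳ Lnum (∈-++⁺ʳ LnI (∈-++⁺ˡ (∈-map⁺ (λ x → (num x , pInf)) (∈-upTo⁺ (v→ vy)))))) (inj₂ (refl , refl))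
  common-listed nInf pInf vx vy ne c = inRest (here (inj₁ (refl , refl)))
  common-listed pInf nInf vx vy ne c = inRest (here (inj₂ (refl , refl)))
  common-listed nInf nInf vx vy ne c = ⊥-elim (ne refl)
  common-listed pInf pInf vx vy ne c = ⊥-elim (ne refl)

  common-count : NumCommonEdges n (2 * n * n ∸ 3 * n + 4)
  common-count = commonList , listed-length , listed-distinct , listed-common , common-listed

  main : IsOneFactorisation (V₁ n) (2 * n ∸ 1) (F¹ n) × IsOneFactorisation (V₂ n) (2 * n + 1) (F² n) × NumCommonEdges n (2 * n * n ∸ 3 * n + 4)
  main = G1.oneFactorisation , G2.oneFactorisation , common-count

-- For n = 2q + 4 (N = 2q + 2): s = q,
-- u = 3q + 3, h = (n-2)/2 = q + 1 and e* = {u, u + 1}; for n = 2q + 3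
-- (N = 2q + 1): s = q, u = 3q + 1, h = (3n-5)/2 = 3q + 2 and e* = {q, q + 1}.

div2 : ∀ {x} k → x ≡ k * 2 → x / 2 ≡ k
div2 k e = trans (cong (_/ 2) e) (m*n/n≡m k 2)

module EvenP (q : ℕ) where
  N n U : ℕ
  N = suc (suc (q + q))
  n = suc (suc N)
  U = suc (suc (suc (q + q + q)))

  isE : isEven n ≡ true
  isE = trans (cong (λ z → z % 2 ≡ᵇ 0) (l q)) (cong (_≡ᵇ 0) (m*n%n≡0 (suc (suc q)) 2))
    where l : ∀ q → suc (suc (suc (suc (q + q)))) ≡ suc (suc q) * 2
          l = solve-∀

  sE : s n ≡ q
  sE = trans (cong (λ b → if b then (n ∸ 4) / 2 else (n ∸ 3) / 2) isE) (div2 q (l q))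
    where l : ∀ q → q + q ≡ q * 2
          l = solve-∀

  uE : u n ≡ U
  uE = trans (cong (λ b → if b then (3 * n ∸ 6) / 2 else (3 * n ∸ 7) / 2) isE)
         (div2 U (trans (cong (_∸ 6) (l q)) (m+n∸m≡n 6 (U * 2))))
    where l : ∀ q → 3 * suc (suc (suc (suc (q + q)))) ≡ 6 + suc (suc (suc (q + q + q))) * 2
          l = solve-∀

  SE : 3 * n ∸ 5 ≡ S N
  SE = trans (cong (_∸ 5) (l q)) (m+n∸m≡n 5 (S N))
    where l : ∀ q → 3 * suc (suc (suc (suc (q + q)))) ≡ 5 + suc (suc (suc (q + q)) + (suc (suc (q + q)) + suc (suc (q + q))))
          l = solve-∀

  SU : S N ≡ U + suc U
  SU = l q
    where l : ∀ q → suc (suc (suc (q + q)) + (suc (suc (q + q)) + suc (suc (q + q)))) ≡ suc (suc (suc (q + q + q))) + suc (suc (suc (suc (q + q + q))))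
          l = solve-∀

  vE : v n ≡ suc U
  vE = trans (cong₂ _∸_ SE uE) (trans (cong (_∸ U) SU) (m+n∸m≡n U (suc U)))

  hE : (n ∸ 2) / 2 ≡ suc q
  hE = div2 (suc q) (l q)
    where l : ∀ q → suc (suc (q + q)) ≡ suc q * 2
          l = solve-∀

  M1E : 2 * n ∸ 3 ≡ suc (N + N)
  M1E = trans (cong (_∸ 3) (l q)) (m+n∸m≡n 3 (suc (N + N)))
    where l : ∀ q → 2 * suc (suc (suc (suc (q + q)))) ≡ 3 + suc (suc (suc (q + q)) + suc (suc (q + q)))
          l = solve-∀

  params : Params N
  params = record
    { h = suc q
    ; h-prop = inj₁ (s≤s (≤-trans (m≤m+n q q) (n≤1+n _)) , cong suc (+-suc q q))
    ; s-lo = λ x le → let le' = subst (x ≤_) sE le in s≤s (m≤n⇒m≤1+n (+-mono-≤ le' le'))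
    ; s-cov = scov
    ; u-lo = λ x le → let le' = subst (x ≤_) uE le in subst (suc (x + x) ≤_) (sym (trans SU (+-suc U U))) (s≤s (+-mono-≤ le' le'))
    ; u-cov = ucov
    ; E₃≡ = trans (cong (λ b → if b then (num ((n ∸ 2) / 2) , nInf) ∷ (num (2 * n ∸ 3) , pInf) ∷ []
                               else (num ((3 * n ∸ 5) / 2) , nInf) ∷ (num (2 * n ∸ 3) , pInf) ∷ []) isE)
                   (cong₂ (λ x y → (num x , nInf) ∷ (num y , pInf) ∷ []) hE M1E)
    ; e0 = U
    ; e0-prop = inj₂ (≤w q (l1 q) , sym SU)
    ; e0-bound = ≤w q (l2 q)
    ; E₄≡ = trans (cong (λ b → if b then (num (u n) , niInf) ∷ (num (v n) , piInf) ∷ []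
                               else (num (s n) , niInf) ∷ (num (t n) , piInf) ∷ []) isE)
                   (cong₂ (λ x y → (num x , niInf) ∷ (num y , piInf) ∷ []) uE vE)
    ; e*≡ = trans (cong (λ b → if b then (num (u n) , num (v n)) else (num (s n) , num (t n))) isE)
                   (cong₂ (λ x y → (num x , num y)) uE vE)
    }
    where
    l1 : ∀ q → suc (suc (suc (q + q + q))) ≡ suc (suc (suc (q + q))) + q
    l1 = solve-∀
    l2 : ∀ q → suc (suc (suc (suc (q + q)) + suc (suc (q + q)))) ≡ suc (suc (suc (suc (suc (suc (q + q + q)))))) + q
    l2 = solve-∀
    scov : ∀ a → a ≤ N → a ≢ suc q → a ≤ s n ⊎ N ∸ a ≤ s n
    scov a aN ne with a ≤? q
    ... | yes le = inj₁ (subst (a ≤_) (sym sE) le)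
    ... | no nle = inj₂ (subst (N ∸ a ≤_) (sym sE) (subst (N ∸ a ≤_) (m+n∸m≡n q q)
                     (∸-monoʳ-≤ N (≤∧≢⇒< (≰⇒> nle) (λ e → ne (sym e))))))
    ucov : ∀ a → N < a → a ≤ N + N → a ≢ suc q → a ≤ u n ⊎ S N ∸ a ≤ u n
    ucov a _ _ _ with a ≤? U
    ... | yes le = inj₁ (subst (a ≤_) (sym uE) le)
    ... | no nle = inj₂ (subst (S N ∸ a ≤_) (sym uE) (≤-trans (∸-monoʳ-≤ (S N) (≰⇒> nle))
                     (≤-reflexive (trans (cong (_∸ suc U) (trans SU (+-suc U U))) (m+n∸m≡n (suc U) U)))))

module OddP (q : ℕ) where
  N n U H : ℕ
  N = suc (q + q)
  n = suc (suc N)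
  U = suc (q + q + q)
  H = suc (suc (q + q + q))

  isO : isEven n ≡ false
  isO = trans (cong (λ z → z % 2 ≡ᵇ 0) (l q)) (cong (_≡ᵇ 0) ([m+kn]%n≡m%n 1 (suc q) 2))
    where l : ∀ q → suc (suc (suc (q + q))) ≡ 1 + suc q * 2
          l = solve-∀

  sO : s n ≡ q
  sO = trans (cong (λ b → if b then (n ∸ 4) / 2 else (n ∸ 3) / 2) isO) (div2 q (l q))
    where l : ∀ q → q + q ≡ q * 2
          l = solve-∀

  uO : u n ≡ U
  uO = trans (cong (λ b → if b then (3 * n ∸ 6) / 2 else (3 * n ∸ 7) / 2) isO)
         (div2 U (trans (cong (_∸ 7) (l q)) (m+n∸m≡n 7 (U * 2))))
    where l : ∀ q → 3 * suc (suc (suc (q + q))) ≡ 7 + suc (q + q + q) * 2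
          l = solve-∀

  tO : t n ≡ suc q
  tO = trans (cong (N ∸_) sO) (trans (cong (_∸ q) (l q)) (m+n∸m≡n q (suc q)))
    where l : ∀ q → suc (q + q) ≡ q + suc q
          l = solve-∀

  SH : S N ≡ H + H
  SH = l q
    where l : ∀ q → suc (suc (q + q) + (suc (q + q) + suc (q + q))) ≡ suc (suc (q + q + q)) + suc (suc (q + q + q))
          l = solve-∀

  hO : (3 * n ∸ 5) / 2 ≡ H
  hO = div2 H (trans (cong (_∸ 5) (l q)) (m+n∸m≡n 5 (H * 2)))
    where l : ∀ q → 3 * suc (suc (suc (q + q))) ≡ 5 + suc (suc (q + q + q)) * 2
          l = solve-∀

  M1O : 2 * n ∸ 3 ≡ suc (N + N)
  M1O = trans (cong (_∸ 3) (l q)) (m+n∸m≡n 3 (suc (N + N)))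
    where l : ∀ q → 2 * suc (suc (suc (q + q))) ≡ 3 + suc (suc (q + q) + suc (q + q))
          l = solve-∀

  params : Params N
  params = record
    { h = H
    ; h-prop = inj₂ (≤w q (l1 q) , ≤w q (l2 q) , sym SH)
    ; s-lo = λ x le → let le' = subst (x ≤_) sO le in s≤s (+-mono-≤ le' le')
    ; s-cov = scov
    ; u-lo = λ x le → let le' = subst (x ≤_) uO le in subst (suc (x + x) ≤_) (sym (trans SH (cong suc (+-suc U U)))) (s≤s (m≤n⇒m≤1+n (+-mono-≤ le' le')))
    ; u-cov = ucov
    ; E₃≡ = trans (cong (λ b → if b then (num ((n ∸ 2) / 2) , nInf) ∷ (num (2 * n ∸ 3) , pInf) ∷ []
                               else (num ((3 * n ∸ 5) / 2) , nInf) ∷ (num (2 * n ∸ 3) , pInf) ∷ []) isO)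
                   (cong₂ (λ x y → (num x , nInf) ∷ (num y , pInf) ∷ []) hO M1O)
    ; e0 = q
    ; e0-prop = inj₁ (s≤s (m≤m+n q q) , +-suc q q)
    ; e0-bound = ≤w (suc (q + q + q)) (l3 q)
    ; E₄≡ = trans (cong (λ b → if b then (num (u n) , niInf) ∷ (num (v n) , piInf) ∷ []
                               else (num (s n) , niInf) ∷ (num (t n) , piInf) ∷ []) isO)
                   (cong₂ (λ x y → (num x , niInf) ∷ (num y , piInf) ∷ []) sO tO)
    ; e*≡ = trans (cong (λ b → if b then (num (u n) , num (v n)) else (num (s n) , num (t n))) isO)
                   (cong₂ (λ x y → (num x , num y)) sO tO)
    }
    where
    l1 : ∀ q → suc (suc (q + q + q)) ≡ suc (suc (q + q)) + q
    l1 = solve-∀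
    l2 : ∀ q → suc (q + q) + suc (q + q) ≡ suc (suc (q + q + q)) + q
    l2 = solve-∀
    l3 : ∀ q → suc (suc (suc (q + q) + suc (q + q))) ≡ suc (suc (suc q)) + suc (q + q + q)
    l3 = solve-∀
    scov : ∀ a → a ≤ N → a ≢ H → a ≤ s n ⊎ N ∸ a ≤ s n
    scov a aN ne with a ≤? q
    ... | yes le = inj₁ (subst (a ≤_) (sym sO) le)
    ... | no nle = inj₂ (subst (N ∸ a ≤_) (sym sO) (subst (N ∸ a ≤_) (m+n∸m≡n q q) (∸-monoʳ-≤ N (≰⇒> nle))))
    ucov : ∀ a → N < a → a ≤ N + N → a ≢ H → a ≤ u n ⊎ S N ∸ a ≤ u n
    ucov a _ _ ne with a ≤? U
    ... | yes le = inj₁ (subst (a ≤_) (sym uO) le)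
    ... | no nle = inj₂ (subst (S N ∸ a ≤_) (sym uO) (≤-trans (∸-monoʳ-≤ (S N) (≤∧≢⇒< (≰⇒> nle) (λ e → ne (sym e))))
                     (≤-reflexive (trans (cong (_∸ suc H) (trans SH (+-suc H (suc (q + q + q))))) (m+n∸m≡n (suc H) U)))))

params : ∀ N → 1 ≤ N → Params N
params N N≥1 = by-parity (half-spec N)
  where
  by-parity : (ev N ≡ true × N ≡ half N + half N) ⊎ (ev N ≡ false × N ≡ suc (half N + half N)) → Params N
  by-parity (inj₁ (_ , e)) with half N
  ... | zero = ⊥-elim (<⇒≢ N≥1 (sym e))
  ... | suc q = subst Params (sym (trans e (cong suc (+-suc q q)))) (EvenP.params q)
  by-parity (inj₂ (_ , e)) = subst Params (sym e) (OddP.params (half N))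

theorem4p2 : (n : ℕ) → 3 ≤ n →
    IsOneFactorisation (V₁ n) (2 * n ∸ 1) (F¹ n) ×
    IsOneFactorisation (V₂ n) (2 * n + 1) (F² n) ×
    NumCommonEdges n (2 * n * n ∸ 3 * n + 4)
theorem4p2 (suc (suc N)) (s≤s (s≤s N≥1)) = Construction.main N N≥1 (params N N≥1)
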